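{- The number of minimal forts for $C_{n}$ satisfies \[ \lvert\mathcal{F}_{C_{n}}\rvert = \text{round}(\psi^{n}),~n\geq 10, \] where $\text{round}(\cdot)$ denotes rounding to the nearest integer. Moreover, the limit of successive ratios satisfies \[ \lim_{n\rightarrow\infty}\frac{\lvert\mathcal{F}_{C_{n+1}}\rvert}{\lvert\mathcal{F}_{C_{n}}\rvert} = \psi, \] where $\psi=1.3247179572\ldots$ denotes the plastic ratio.
   Context: For a graph $G=(V,E)$, a non-empty subset $F\subseteq V$ is a fort if no vertex outside $F$ has exactly one neighbor in $F$; a fort is minimal if every proper subset is not a fort. $\mathcal{F}_{G}$ denotes the collection of all minimal forts of $G$. $C_{n}$ is the cycle graph on $n$ vertices. The plastic ratio $\psi$ is the unique real root of $\lambda^{3}-\lambda-1$. -}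

module Defs where

open import Data.Nat as ℕ using (ℕ; zero; suc; _≟_)
open import Data.Fin using (Fin; toℕ)
open import Data.Fin.Subset using (Subset; _∈_; _∉_; _⊂_; Nonempty; inside; outside)
open import Data.Fin.Subset.Properties using (_∈?_; _⊂?_; nonempty?; anySubset?)
open import Data.Fin.Properties using (all?)
open import Data.List using (List; []; _∷_; _++_; map; filter; length; allFin)
open import Data.Vec using ([]; _∷_)
open import Data.Product using (_×_; _,_; ∃; ∃-syntax; proj₁; proj₂)
open import Data.Sum using (_⊎_)
open import Data.Integer using (+_)
open import Data.Rational using (ℚ; _+_; _-_; _*_; _<_; 0ℚ; 1ℚ; ½; _/_)
open import Relation.Binary.PropositionalEquality using (_≡_; _≢_)
open import Relation.Nullary using (¬_; Dec; yes; no; ¬?)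
open import Relation.Nullary.Decidable using (_×-dec_; _⊎-dec_; _→-dec_; map′)

-- The cycle graph C_n on vertex set Fin n (vertices 0,…,n-1; i ~ i+1 mod n).
-- This is the cycle C_n for n ≥ 3 (the statement only uses n ≥ 10).

CycleAdj : (n : ℕ) → Fin n → Fin n → Set
CycleAdj n i j =
  (toℕ j ≡ suc (toℕ i)) ⊎ (toℕ i ≡ suc (toℕ j))
  ⊎ (toℕ i ≡ 0 × suc (toℕ j) ≡ n) ⊎ (toℕ j ≡ 0 × suc (toℕ i) ≡ n)

cycleAdj? : (n : ℕ) (i j : Fin n) → Dec (CycleAdj n i j)
cycleAdj? n i j =
  (toℕ j ≟ suc (toℕ i)) ⊎-dec (toℕ i ≟ suc (toℕ j))
  ⊎-dec ((toℕ i ≟ 0) ×-dec (suc (toℕ j) ≟ n))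
  ⊎-dec ((toℕ j ≟ 0) ×-dec (suc (toℕ i) ≟ n))

nbrsIn : (n : ℕ) → Subset n → Fin n → ℕ
nbrsIn n F v = length (filter (λ u → (u ∈? F) ×-dec cycleAdj? n v u) (allFin n))

Fort : (n : ℕ) → Subset n → Set
Fort n F = Nonempty F × (∀ v → v ∉ F → nbrsIn n F v ≢ 1)

MinimalFort : (n : ℕ) → Subset n → Set
MinimalFort n F = Fort n F × (∀ G → G ⊂ F → ¬ Fort n G)

fort? : (n : ℕ) (F : Subset n) → Dec (Fort n F)
fort? n F = nonempty? F ×-dec all? (λ v → ¬? (v ∈? F) →-dec ¬? (nbrsIn n F v ≟ 1))

minimalFort? : (n : ℕ) (F : Subset n) → Dec (MinimalFort n F)
minimalFort? n F = fort? n F ×-dec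
  map′ (λ ¬∃ G G⊂F fG → ¬∃ (G , G⊂F , fG))
       (λ h (G , G⊂F , fG) → h G G⊂F fG)
       (¬? (anySubset? (λ G → (G ⊂? F) ×-dec fort? n G)))

allSubsets : (n : ℕ) → List (Subset n)
allSubsets zero = [] ∷ []
allSubsets (suc n) = map (inside ∷_) (allSubsets n) ++ map (outside ∷_) (allSubsets n)

numMinForts : ℕ → ℕ
numMinForts n = length (filter (minimalFort? n) (allSubsets n))

-- The plastic ratio ψ, the unique real root of λ³ - λ - 1, as a Dedekind cut.
-- Since p(x) = x³ - x - 1 has a single real root ψ, for rational q:
--   q < ψ  ⟺  p(q) < 0,   and   ψ < q  ⟺  0 < p(q).

powℚ : ℚ → ℕ → ℚ
powℚ q zero = 1ℚ
powℚ q (suc k) = q * powℚ q k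

plasticPoly : ℚ → ℚ
plasticPoly q = q * q * q - q - 1ℚ

BelowPsi : ℚ → Set
BelowPsi q = plasticPoly q < 0ℚ

AbovePsi : ℚ → Set
AbovePsi q = 0ℚ < plasticPoly q

ℕtoℚ : ℕ → ℚ
ℕtoℚ m = + m / 1

-- N = round(ψ^n), i.e. N - 1/2 < ψ^n < N + 1/2 (ψ^n is irrational for n ≥ 1,
-- so there are no ties). Expressed through rational bounds 0 < r < ψ < s:
-- ψ^n > N - 1/2 iff some rational 0 < r < ψ has r^n > N - 1/2, and
-- ψ^n < N + 1/2 iff some rational s > ψ has s^n < N + 1/2.
IsRoundPsiPow : ℕ → ℕ → Set
IsRoundPsiPow n N =
  (∃[ r ] (0ℚ < r × BelowPsi r × ℕtoℚ N - ½ < powℚ r n))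
  × (∃[ s ] (AbovePsi s × powℚ s n < ℕtoℚ N + ½))

-- the rational b / a (defined as 0 when a = 0; only used where a ≠ 0 eventually)
ratioℕ : ℕ → ℕ → ℚ
ratioℕ b zero = 0ℚ
ratioℕ b (suc a) = + b / suc a

-- |q - ψ| < ε  ⟺  q - ε < ψ < q + ε
WithinOfPsi : ℚ → ℚ → Set
WithinOfPsi ε q = BelowPsi (q - ε) × AbovePsi (q + ε)

module Submission where

-- A subset F of C_n (n ≥ 3) is a fort iff it is non-empty and every vertex outside F has both
-- neighbours in F: a vertex outside F with both neighbours outside would, by the fort condition,
-- push the gap around the whole cycle. Such a fort is minimal iff no vertex of F has both neighbours
-- in F, since that vertex could be removed. So the minimal forts are the cyclic binary words in
-- which every letter is the NAND of its two neighbours. A transfer matrix on pairs of consecutive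
-- letters counts them, and its trace is the Perrin number P(n), with P(n+3) = P(n+1) + P(n).
--
-- Over ℚ, the error P(n) - xⁿ for a rational x near ψ is controlled by a quadratic form in two
-- consecutive errors which, for x = ψ, contracts by the factor ψ² - 1 ≈ 0.755 at each step. A
-- bisection gives rationals x < ψ < x' close enough for the perturbation to stay negligible up to
-- any prescribed n; since 4 (ψ² - 1)¹⁰ < ¼, both xⁿ and x'ⁿ then lie within ½ of P(n) for n ≥ 10.
-- The same brackets trap the ratio P(n+1)/P(n) once P(n) is large.

open import Defs
open import Agda.Builtin.FromNat using (Number; fromNat)
open import Data.Unit.Base using (tt)
open import Data.Integer using (ℤ)
import Data.Integer.Literals as ℤLiterals
open import Data.Nat as ℕ using (ℕ; zero; suc)
import Data.Nat.Literals as ℕLiterals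
import Data.Nat.Properties as ℕP
open import Data.Rational using (ℚ)
import Data.Rational.Literals as ℚLiterals
open import Relation.Binary.PropositionalEquality

instance
  ℕ-number : Number ℕ
  ℕ-number = ℕLiterals.number
  ℤ-number : Number ℤ
  ℤ-number = ℤLiterals.number
  ℚ-number : Number ℚ
  ℚ-number = ℚLiterals.number

module Perrin where

  open import Data.Nat using (_+_; _*_; _≤_; z≤n; s≤s)
  open import Data.Nat.Tactic.RingSolver using (solve-∀)
  open import Data.Product using (_,_)

  perrin : ℕ → ℕ
  perrin 0 = 3
  perrin 1 = 0
  perrin 2 = 2
  perrin (suc (suc (suc n))) = perrin (suc n) + perrin n

  perrin-pos : ∀ m → 1 ≤ perrin (2 + m)
  perrin-pos 0 = s≤s z≤n
  perrin-pos 1 = s≤s z≤n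
  perrin-pos 2 = s≤s z≤n
  perrin-pos (suc (suc (suc m))) = ℕP.≤-trans (perrin-pos (suc m)) (ℕP.m≤m+n _ _)

  perrin-linear : ∀ m → m ≤ 3 * perrin (2 + m)
  perrin-linear 0 = z≤n
  perrin-linear 1 = s≤s z≤n
  perrin-linear 2 = s≤s (s≤s z≤n)
  perrin-linear (suc (suc (suc m))) = begin
    3 + m                                      ≤⟨ ℕP.n≤1+n _ ⟩
    4 + m                                      ≡⟨ ℕP.+-comm (1 + m) 3 ⟨
    (1 + m) + 3                                ≤⟨ ℕP.+-mono-≤ (perrin-linear (suc m)) (ℕP.*-monoʳ-≤ 3 (perrin-pos m)) ⟩
    3 * perrin (3 + m) + 3 * perrin (2 + m)    ≡⟨ ℕP.*-distribˡ-+ 3 (perrin (3 + m)) (perrin (2 + m)) ⟨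
    3 * perrin (5 + m)                         ∎
    where open ℕP.≤-Reasoning

  perrin-eventually-≥ : ∀ c n → 3 * c + 2 ≤ n → c ≤ perrin n
  perrin-eventually-≥ c n 3c+2≤n with ℕP.m≤n⇒∃[o]m+o≡n 3c+2≤n
  ... | o , refl = subst (λ k → c ≤ perrin k) (reorder (3 * c) o)
                         (ℕP.*-cancelˡ-≤ 3 (ℕP.≤-trans (ℕP.m≤m+n (3 * c) o) (perrin-linear (3 * c + o))))
    where
    reorder : ∀ a o → 2 + (a + o) ≡ a + 2 + o
    reorder = solve-∀

open Perrin using (perrin)

module MinimalForts where

  open import Algebra.Properties.CommutativeSemigroup ℕP.+-commutativeSemigroup using (interchange)
  open import Data.Bool using (Bool; true; false; not; _∧_; T)
  import Data.Bool as Bool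
  open import Data.Bool.Properties using (T-∧; T-≡; ¬-not)
  open import Data.Fin as Fin using (Fin; zero; suc; toℕ; fromℕ; inject₁; lower₁)
  open import Data.Fin.Induction using (<-weakInduction; >-weakInduction)
  import Data.Fin.Properties as FinP
  open import Data.Fin.Subset using (Subset; _∉_; _⊂_; _⊆_; Nonempty)
  open import Data.Fin.Subset.Properties using (_∈?_)
  open import Data.List using (List; []; _∷_; _++_; map; filter; length; allFin)
  open import Data.List.Membership.Propositional using () renaming (_∈_ to _∈ₗ_)
  open import Data.List.Membership.Propositional.Properties using (∈-allFin)
  open import Data.List.Relation.Unary.All using (All; []; _∷_)
  import Data.List.Relation.Unary.All as All
  open import Data.List.Relation.Unary.Any using (here; there)
  open import Data.List.Relation.Unary.Unique.Propositional using (Unique; []; _∷_)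
  open import Data.List.Relation.Unary.Unique.Propositional.Properties using (allFin⁺)
  open import Data.Nat using (_+_; _*_)
  open import Data.Nat.Tactic.RingSolver using (solve-∀)
  open import Data.Product using (_×_; _,_; proj₁; proj₂)
  open import Data.Product.Properties using (≡-dec)
  open import Data.Sum using (_⊎_; inj₁; inj₂)
  open import Data.Vec using (Vec; []; _∷_; lookup; _[_]≔_)
  import Data.Vec.Properties as VecP
  open import Function using (_∘_; id; _⇔_; mk⇔; Equivalence)
  open import Level using (Level)
  open import Relation.Nullary using (¬_; Dec; yes; no; does; contradiction)
  open import Relation.Nullary.Decidable using (_×-dec_; _⊎-dec_; ⌊_⌋; dec-true; dec-false; does-⇔; toWitness; fromWitness)
  open import Relation.Nullary.Decidable.Core using (T?)
  open import Relation.Unary using (Pred; Decidable)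

  private
    variable
      m k : ℕ
      ℓ : Level

  -- The cycle

  IsNext : ∀ {n} → Fin n → Fin n → Set
  IsNext {n} v u = toℕ u ≡ suc (toℕ v) ⊎ (toℕ u ≡ 0 × suc (toℕ v) ≡ n)

  cycleAdj⇒IsNext : ∀ {n} {v u : Fin n} → CycleAdj n v u → IsNext v u ⊎ IsNext u v
  cycleAdj⇒IsNext (inj₁ a)               = inj₁ (inj₁ a)
  cycleAdj⇒IsNext (inj₂ (inj₁ b))        = inj₂ (inj₁ b)
  cycleAdj⇒IsNext (inj₂ (inj₂ (inj₁ c))) = inj₂ (inj₂ c)
  cycleAdj⇒IsNext (inj₂ (inj₂ (inj₂ d))) = inj₁ (inj₂ d)

  IsNext⇒cycleAdj : ∀ {n} {v u : Fin n} → IsNext v u ⊎ IsNext u v → CycleAdj n v u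
  IsNext⇒cycleAdj (inj₁ (inj₁ a)) = inj₁ a
  IsNext⇒cycleAdj (inj₁ (inj₂ d)) = inj₂ (inj₂ (inj₂ d))
  IsNext⇒cycleAdj (inj₂ (inj₁ b)) = inj₂ (inj₁ b)
  IsNext⇒cycleAdj (inj₂ (inj₂ c)) = inj₂ (inj₂ (inj₁ c))

  next : Fin (suc m) → Fin (suc m)
  next {m} v with m ℕ.≟ toℕ v
  ... | yes _  = zero
  ... | no m≢v = lower₁ (suc v) (m≢v ∘ ℕP.suc-injective)

  prev : Fin (suc m) → Fin (suc m)
  prev zero    = fromℕ _
  prev (suc v) = inject₁ v

  IsNext-next : (v : Fin (suc m)) → IsNext v (next v)
  IsNext-next {m} v with m ℕ.≟ toℕ v
  ... | yes m≡v = inj₂ (refl , cong suc (sym m≡v))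
  ... | no m≢v  = inj₁ (FinP.toℕ-lower₁ (suc v) (m≢v ∘ ℕP.suc-injective))

  IsNext-prev : (v : Fin (suc m)) → IsNext (prev v) v
  IsNext-prev {m} zero = inj₂ (refl , cong suc (FinP.toℕ-fromℕ m))
  IsNext-prev (suc v)  = inj₁ (cong suc (sym (FinP.toℕ-inject₁ v)))

  IsNext⇒≡next : {v u : Fin (suc m)} → IsNext v u → u ≡ next v
  IsNext⇒≡next {m} {v} {u} v→u with m ℕ.≟ toℕ v | v→u
  ... | yes m≡v | inj₁ u≡1+v       = contradiction (trans u≡1+v (cong suc (sym m≡v))) (ℕP.<⇒≢ (FinP.toℕ<n u))
  ... | yes _   | inj₂ (u≡0 , _)   = FinP.toℕ-injective u≡0
  ... | no m≢v  | inj₁ u≡1+v       = FinP.toℕ-injective (trans u≡1+v (sym (FinP.toℕ-lower₁ (suc v) (m≢v ∘ ℕP.suc-injective))))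
  ... | no m≢v  | inj₂ (_ , 1+v≡n) = contradiction (sym (ℕP.suc-injective 1+v≡n)) m≢v

  IsNext⇒≡prev : {v u : Fin (suc m)} → IsNext v u → v ≡ prev u
  IsNext⇒≡prev {m} {u = zero} (inj₂ (_ , 1+v≡n)) =
    FinP.toℕ-injective (trans (ℕP.suc-injective 1+v≡n) (sym (FinP.toℕ-fromℕ m)))
  IsNext⇒≡prev {u = suc u} (inj₁ 1+u≡1+v) =
    FinP.toℕ-injective (trans (sym (ℕP.suc-injective 1+u≡1+v)) (sym (FinP.toℕ-inject₁ u)))

  prev-next : (v : Fin (suc m)) → prev (next v) ≡ v
  prev-next v = sym (IsNext⇒≡prev (IsNext-next v))

  next-prev : (v : Fin (suc m)) → next (prev v) ≡ v
  next-prev v = sym (IsNext⇒≡next (IsNext-prev v))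

  cycleAdj⇔ : {v u : Fin (suc m)} → CycleAdj (suc m) v u ⇔ (u ≡ prev v ⊎ u ≡ next v)
  cycleAdj⇔ {v = v} {u} = mk⇔ to from
    where
    to : CycleAdj _ v u → u ≡ prev v ⊎ u ≡ next v
    to adj with cycleAdj⇒IsNext adj
    ... | inj₁ v→u = inj₂ (IsNext⇒≡next v→u)
    ... | inj₂ u→v = inj₁ (IsNext⇒≡prev u→v)
    from : u ≡ prev v ⊎ u ≡ next v → CycleAdj _ v u
    from (inj₁ refl) = IsNext⇒cycleAdj (inj₂ (IsNext-prev v))
    from (inj₂ refl) = IsNext⇒cycleAdj (inj₁ (IsNext-next v))

  ¬IsNext-refl : {v : Fin (2 + k)} → ¬ IsNext v v
  ¬IsNext-refl (inj₁ v≡1+v) = ℕP.1+n≢n (sym v≡1+v)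
  ¬IsNext-refl (inj₂ (v≡0 , 1+v≡n)) with trans (sym (cong suc v≡0)) 1+v≡n
  ... | ()

  ¬IsNext-sym : {v u : Fin (3 + k)} → IsNext v u → ¬ IsNext u v
  ¬IsNext-sym {v = v} (inj₁ u≡1+v) (inj₁ v≡1+u) = ℕP.m≢1+n+m (toℕ v) (trans v≡1+u (cong suc u≡1+v))
  ¬IsNext-sym (inj₁ u≡1+v) (inj₂ (v≡0 , 1+u≡n))
    with trans (sym (cong suc (trans u≡1+v (cong suc v≡0)))) 1+u≡n
  ... | ()
  ¬IsNext-sym (inj₂ (u≡0 , 1+v≡n)) (inj₁ v≡1+u)
    with trans (sym (cong suc (trans v≡1+u (cong suc u≡0)))) 1+v≡n
  ... | ()
  ¬IsNext-sym (inj₂ (u≡0 , _)) (inj₂ (_ , 1+u≡n)) with trans (sym (cong suc u≡0)) 1+u≡n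
  ... | ()

  next≢self : (v : Fin (3 + k)) → next v ≢ v
  next≢self v eq = ¬IsNext-refl (subst (IsNext v) eq (IsNext-next v))

  prev≢self : (v : Fin (3 + k)) → prev v ≢ v
  prev≢self v eq = ¬IsNext-refl (subst (λ u → IsNext u v) eq (IsNext-prev v))

  prev≢next : (v : Fin (3 + k)) → prev v ≢ next v
  prev≢next v eq = ¬IsNext-sym (IsNext-prev v) (subst (IsNext v) (sym eq) (IsNext-next v))

  prev-closed⇒all : (P : Pred (Fin (suc m)) ℓ) → (∀ v → P v → P (prev v)) → ∀ {v} → P v → ∀ u → P u
  prev-closed⇒all P step {v} Pv = >-weakInduction P (step zero P₀) (λ i → step (suc i))
    where
    P₀ : P zero
    P₀ = <-weakInduction (λ u → P u → P zero) id (λ i ih → ih ∘ step (suc i)) v Pv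

  𝟙 : Bool → ℕ
  𝟙 true  = 1
  𝟙 false = 0

  𝟙-∧ : ∀ a b → 𝟙 (a ∧ b) ≡ 𝟙 a * 𝟙 b
  𝟙-∧ true  b = sym (ℕP.+-identityʳ (𝟙 b))
  𝟙-∧ false b = refl

  ∑ : ∀ {a} {A : Set a} → (A → ℕ) → List A → ℕ
  ∑ f []       = 0
  ∑ f (x ∷ xs) = f x + ∑ f xs

  module _ {a} {A : Set a} where

    ∑-cong : {f g : A → ℕ} → (∀ x → f x ≡ g x) → ∀ xs → ∑ f xs ≡ ∑ g xs
    ∑-cong f≗g []       = refl
    ∑-cong f≗g (x ∷ xs) = cong₂ _+_ (f≗g x) (∑-cong f≗g xs)

    ∑-++ : (f : A → ℕ) (xs ys : List A) → ∑ f (xs ++ ys) ≡ ∑ f xs + ∑ f ys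
    ∑-++ f []       ys = refl
    ∑-++ f (x ∷ xs) ys = trans (cong (f x +_) (∑-++ f xs ys)) (sym (ℕP.+-assoc (f x) _ _))

    ∑-map : ∀ {b} {B : Set b} (f : B → ℕ) (g : A → B) (xs : List A) → ∑ f (map g xs) ≡ ∑ (f ∘ g) xs
    ∑-map f g []       = refl
    ∑-map f g (x ∷ xs) = cong (f (g x) +_) (∑-map f g xs)

    ∑-+ : (f g : A → ℕ) (xs : List A) → ∑ (λ x → f x + g x) xs ≡ ∑ f xs + ∑ g xs
    ∑-+ f g []       = refl
    ∑-+ f g (x ∷ xs) = trans (cong (f x + g x +_) (∑-+ f g xs)) (interchange (f x) (g x) (∑ f xs) (∑ g xs))

    ∑-*ˡ : (c : ℕ) (f : A → ℕ) (xs : List A) → ∑ (λ x → c * f x) xs ≡ c * ∑ f xs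
    ∑-*ˡ c f []       = sym (ℕP.*-zeroʳ c)
    ∑-*ˡ c f (x ∷ xs) = trans (cong (c * f x +_) (∑-*ˡ c f xs)) (sym (ℕP.*-distribˡ-+ c (f x) _))

    ∑-zero : {f : A → ℕ} {xs : List A} → All (λ x → f x ≡ 0) xs → ∑ f xs ≡ 0
    ∑-zero []           = refl
    ∑-zero (fx≡0 ∷ all) = cong₂ _+_ fx≡0 (∑-zero all)

    ∑-pointMass : {f : A → ℕ} {xs : List A} {y : A} → Unique xs → y ∈ₗ xs → (∀ x → x ≢ y → f x ≡ 0) → ∑ f xs ≡ f y
    ∑-pointMass {f} (x≢xs ∷ _) (here refl) off =
      trans (cong (f _ +_) (∑-zero (All.map (λ x≢z → off _ (x≢z ∘ sym)) x≢xs))) (ℕP.+-identityʳ _)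
    ∑-pointMass (x≢xs ∷ uniq) (there y∈xs) off =
      cong₂ _+_ (off _ (λ x≡y → All.lookup x≢xs y∈xs x≡y)) (∑-pointMass uniq y∈xs off)

    length-filter≡∑ : ∀ {p} {P : Pred A p} (P? : Decidable P) (xs : List A) → length (filter P? xs) ≡ ∑ (𝟙 ∘ does ∘ P?) xs
    length-filter≡∑ P? []       = refl
    length-filter≡∑ P? (x ∷ xs) with does (P? x)
    ... | true  = cong suc (length-filter≡∑ P? xs)
    ... | false = length-filter≡∑ P? xs

  ∑-swap : ∀ {a b} {A : Set a} {B : Set b} (f : A → B → ℕ) (xs : List A) (ys : List B) →
           ∑ (λ x → ∑ (f x) ys) xs ≡ ∑ (λ y → ∑ (λ x → f x y) xs) ys
  ∑-swap f []       ys = sym (∑-zero (All.universal (λ _ → refl) ys))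
  ∑-swap f (x ∷ xs) ys = trans (cong (∑ (f x) ys +_) (∑-swap f xs ys)) (sym (∑-+ (f x) _ ys))

  ∑-at : ∀ {n} (f : Fin n → ℕ) (a : Fin n) → ∑ (λ u → f u * 𝟙 (does (u Fin.≟ a))) (allFin n) ≡ f a
  ∑-at f a = trans (∑-pointMass (allFin⁺ _) (∈-allFin a) off) (at a)
    where
    off : ∀ u → u ≢ a → f u * 𝟙 (does (u Fin.≟ a)) ≡ 0
    off u u≢a rewrite dec-false (u Fin.≟ a) u≢a = ℕP.*-zeroʳ (f u)
    at : ∀ u → f u * 𝟙 (does (u Fin.≟ u)) ≡ f u
    at u rewrite dec-true (u Fin.≟ u) refl = ℕP.*-identityʳ (f u)

  -- Forts

  does-∈ : ∀ {n} (u : Fin n) (F : Subset n) → does (u ∈? F) ≡ lookup F u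
  does-∈ zero    (true  ∷ F) = refl
  does-∈ zero    (false ∷ F) = refl
  does-∈ (suc u) (_ ∷ F) with u ∈? F | does-∈ u F
  ... | yes _ | eq = eq
  ... | no _  | eq = eq

  𝟙-cycleAdj : (v u : Fin (3 + k)) →
               𝟙 (does (cycleAdj? _ v u)) ≡ 𝟙 (does (u Fin.≟ prev v)) + 𝟙 (does (u Fin.≟ next v))
  𝟙-cycleAdj v u rewrite does-⇔ cycleAdj⇔ (cycleAdj? _ v u) ((u Fin.≟ prev v) ⊎-dec (u Fin.≟ next v))
    with u Fin.≟ prev v | u Fin.≟ next v
  ... | yes u≡p | yes u≡n = contradiction (trans (sym u≡p) u≡n) (prev≢next v)
  ... | yes _   | no _    = refl
  ... | no _    | yes _   = refl
  ... | no _    | no _    = refl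

  nbrsIn-cycle : ∀ {k} (F : Subset (3 + k)) (v : Fin (3 + k)) →
                 nbrsIn (3 + k) F v ≡ 𝟙 (lookup F (prev v)) + 𝟙 (lookup F (next v))
  nbrsIn-cycle {k} F v = begin
    nbrsIn _ F v
      ≡⟨ length-filter≡∑ (λ u → (u ∈? F) ×-dec cycleAdj? _ v u) (allFin _) ⟩
    ∑ (λ u → 𝟙 (does (u ∈? F) ∧ does (cycleAdj? _ v u))) (allFin _)
      ≡⟨ ∑-cong split (allFin _) ⟩
    ∑ (λ u → at (prev v) u + at (next v) u) (allFin _)
      ≡⟨ ∑-+ (at (prev v)) (at (next v)) (allFin _) ⟩
    ∑ (at (prev v)) (allFin _) + ∑ (at (next v)) (allFin _)
      ≡⟨ cong₂ _+_ (∑-at inF (prev v)) (∑-at inF (next v)) ⟩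
    inF (prev v) + inF (next v) ∎
    where
    open ≡-Reasoning
    inF : Fin (3 + k) → ℕ
    inF u = 𝟙 (lookup F u)
    at : Fin (3 + k) → Fin (3 + k) → ℕ
    at a u = inF u * 𝟙 (does (u Fin.≟ a))
    split : ∀ u → 𝟙 (does (u ∈? F) ∧ does (cycleAdj? _ v u)) ≡ at (prev v) u + at (next v) u
    split u = begin
      𝟙 (does (u ∈? F) ∧ does (cycleAdj? _ v u))                           ≡⟨ 𝟙-∧ (does (u ∈? F)) _ ⟩
      𝟙 (does (u ∈? F)) * 𝟙 (does (cycleAdj? _ v u))                       ≡⟨ cong₂ (λ a b → 𝟙 a * b) (does-∈ u F) (𝟙-cycleAdj v u) ⟩
      inF u * (𝟙 (does (u Fin.≟ prev v)) + 𝟙 (does (u Fin.≟ next v)))     ≡⟨ ℕP.*-distribˡ-+ (inF u) _ _ ⟩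
      at (prev v) u + at (next v) u                                         ∎

  ∉⇒lookup≡false : ∀ {n} {F : Subset n} {x} → x ∉ F → lookup F x ≡ false
  ∉⇒lookup≡false {F = F} {x} x∉F = ¬-not (x∉F ∘ VecP.lookup⇒[]= x F)

  lookup≡false⇒∉ : ∀ {n} {F : Subset n} {x} → lookup F x ≡ false → x ∉ F
  lookup≡false⇒∉ F[x]≡false x∈F with trans (sym (VecP.[]=⇒lookup x∈F)) F[x]≡false
  ... | ()

  OutsideSurrounded : Subset (suc m) → Set
  OutsideSurrounded F = ∀ v → lookup F v ≡ false → lookup F (prev v) ≡ true × lookup F (next v) ≡ true

  module _ {k} {F : Subset (3 + k)} (fort : Fort (3 + k) F) where

    fort-nbrs-agree : ∀ {v} → lookup F v ≡ false → lookup F (prev v) ≡ lookup F (next v)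
    fort-nbrs-agree {v} F[v]≡false with proj₂ fort v (lookup≡false⇒∉ F[v]≡false) | nbrsIn-cycle F v
    ... | ≢1 | count with lookup F (prev v) | lookup F (next v)
    ... | true  | true  = refl
    ... | false | false = refl
    ... | true  | false = contradiction count ≢1
    ... | false | true  = contradiction count ≢1

    -- Two adjacent vertices outside F propagate backwards around the cycle and empty F.
    fort-no-adjacent-outside : ∀ {v} → lookup F v ≡ false → lookup F (next v) ≡ true
    fort-no-adjacent-outside {v} F[v]≡false with lookup F (next v) in F[next]
    ... | true  = refl
    ... | false = contradiction (proj₂ (proj₁ fort))
                    (lookup≡false⇒∉ (proj₁ (prev-closed⇒all Gap step (F[v]≡false , F[next]) (proj₁ (proj₁ fort)))))
      where
      Gap : Fin (3 + k) → Set
      Gap y = lookup F y ≡ false × lookup F (next y) ≡ false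
      step : ∀ y → Gap y → Gap (prev y)
      step y (F[y] , F[next-y]) =
        trans (fort-nbrs-agree F[y]) F[next-y] , trans (cong (lookup F) (next-prev y)) F[y]

    fort⇒OutsideSurrounded : OutsideSurrounded F
    fort⇒OutsideSurrounded v F[v]≡false =
      trans (fort-nbrs-agree F[v]≡false) (fort-no-adjacent-outside F[v]≡false) ,
      fort-no-adjacent-outside F[v]≡false

  OutsideSurrounded⇒fort : ∀ {k} {F : Subset (3 + k)} → Nonempty F → OutsideSurrounded F → Fort (3 + k) F
  OutsideSurrounded⇒fort {F = F} nonempty surrounded = nonempty , two-nbrs
    where
    two-nbrs : ∀ v → v ∉ F → nbrsIn _ F v ≢ 1
    two-nbrs v v∉F count≡1 with surrounded v (∉⇒lookup≡false v∉F)
    ... | F[prev] , F[next]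
      with trans (sym count≡1) (trans (nbrsIn-cycle F v) (cong₂ (λ a b → 𝟙 a + 𝟙 b) F[prev] F[next]))
    ... | ()

  module _ {k} {F : Subset (3 + k)} {v : Fin (3 + k)} (fort : Fort (3 + k) F)
           (F[prev] : lookup F (prev v) ≡ true) (F[next] : lookup F (next v) ≡ true) where

    private
      F-v≡F : ∀ {x} → x ≢ v → lookup (F [ v ]≔ false) x ≡ lookup F x
      F-v≡F x≢v = VecP.lookup∘update′ x≢v F false

      F-v[prev] : lookup (F [ v ]≔ false) (prev v) ≡ true
      F-v[prev] = trans (F-v≡F (prev≢self v)) F[prev]

      F-v-surrounded : OutsideSurrounded (F [ v ]≔ false)
      F-v-surrounded u F-v[u] with u Fin.≟ v
      ... | yes refl = F-v[prev] , trans (F-v≡F (next≢self v)) F[next]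
      ... | no u≢v   = trans (F-v≡F prev-u≢v) (proj₁ F-u-surrounded) , trans (F-v≡F next-u≢v) (proj₂ F-u-surrounded)
        where
        F[u] : lookup F u ≡ false
        F[u] = trans (sym (F-v≡F u≢v)) F-v[u]
        F-u-surrounded : lookup F (prev u) ≡ true × lookup F (next u) ≡ true
        F-u-surrounded = fort⇒OutsideSurrounded fort u F[u]
        prev-u≢v : prev u ≢ v
        prev-u≢v prev-u≡v with trans (sym F[next]) (trans (cong (lookup F) (trans (cong next (sym prev-u≡v)) (next-prev u))) F[u])
        ... | ()
        next-u≢v : next u ≢ v
        next-u≢v next-u≡v with trans (sym F[prev]) (trans (cong (lookup F) (trans (cong prev (sym next-u≡v)) (prev-next u))) F[u])
        ... | ()

    fort-minus-vertex : Fort (3 + k) (F [ v ]≔ false)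
    fort-minus-vertex = OutsideSurrounded⇒fort (prev v , VecP.lookup⇒[]= (prev v) (F [ v ]≔ false) F-v[prev]) F-v-surrounded

    minus-vertex⊂ : lookup F v ≡ true → F [ v ]≔ false ⊂ F
    minus-vertex⊂ F[v] = ⊆F , v , VecP.lookup⇒[]= v F F[v] , lookup≡false⇒∉ (VecP.lookup∘update v F false)
      where
      ⊆F : F [ v ]≔ false ⊆ F
      ⊆F {x} x∈F-v with x Fin.≟ v
      ... | yes refl = VecP.lookup⇒[]= v F F[v]
      ... | no x≢v   = VecP.lookup⇒[]= x F (trans (sym (F-v≡F x≢v)) (VecP.[]=⇒lookup x∈F-v))

  NandCycle : Subset (suc m) → Set
  NandCycle F = ∀ v → lookup F v ≡ not (lookup F (prev v) ∧ lookup F (next v))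

  minimalFort⇒NandCycle : ∀ {k} {F : Subset (3 + k)} → MinimalFort (3 + k) F → NandCycle F
  minimalFort⇒NandCycle {F = F} (fort , minimal) v with lookup F v in F[v]
  ... | false rewrite proj₁ (fort⇒OutsideSurrounded fort v F[v]) | proj₂ (fort⇒OutsideSurrounded fort v F[v]) = refl
  ... | true with lookup F (prev v) in F[prev] | lookup F (next v) in F[next]
  ...   | false | _     = refl
  ...   | true  | false = refl
  ...   | true  | true  = contradiction (fort-minus-vertex fort F[prev] F[next])
                                        (minimal _ (minus-vertex⊂ fort F[prev] F[next] F[v]))

  NandCycle⇒minimalFort : ∀ {k} {F : Subset (3 + k)} → NandCycle F → MinimalFort (3 + k) F
  NandCycle⇒minimalFort {F = F} nand = OutsideSurrounded⇒fort nonempty surrounded , minimal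
    where
    surrounded : OutsideSurrounded F
    surrounded v F[v] with lookup F (prev v) in F[prev] | lookup F (next v) in F[next] | nand v
    ... | true  | true  | _  = refl , refl
    ... | false | _     | eq = contradiction (trans (sym F[v]) eq) (λ ())
    ... | true  | false | eq = contradiction (trans (sym F[v]) eq) (λ ())
    nonempty : Nonempty F
    nonempty with lookup F zero in F[0]
    ... | true  = zero , VecP.lookup⇒[]= zero F F[0]
    ... | false = next zero , VecP.lookup⇒[]= (next zero) F (proj₂ (surrounded zero F[0]))
    minimal : ∀ G → G ⊂ F → ¬ Fort _ G
    minimal G (G⊆F , x , x∈F , x∉G) G-fort
      with fort⇒OutsideSurrounded G-fort x (∉⇒lookup≡false x∉G)
    ... | G[prev] , G[next]
      with trans (sym (VecP.[]=⇒lookup x∈F)) (nand x)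
    ... | eq rewrite VecP.[]=⇒lookup (G⊆F (VecP.lookup⇒[]= _ G G[prev]))
                   | VecP.[]=⇒lookup (G⊆F (VecP.lookup⇒[]= _ G G[next])) with eq
    ... | ()

  -- Counting cyclic words

  Rule : Set
  Rule = Bool → Bool → Bool → Bool

  Satisfies : Rule → Vec Bool (suc m) → Set
  Satisfies R F = ∀ v → T (R (lookup F (prev v)) (lookup F v) (lookup F (next v)))

  State : Set
  State = Bool × Bool

  _≟ₛ_ : (s t : State) → Dec (s ≡ t)
  _≟ₛ_ = ≡-dec Bool._≟_ Bool._≟_

  states : List State
  states = (false , false) ∷ (false , true) ∷ (true , false) ∷ (true , true) ∷ []

  states-unique : Unique states
  states-unique = ((λ ()) ∷ (λ ()) ∷ (λ ()) ∷ []) ∷ ((λ ()) ∷ (λ ()) ∷ []) ∷ ((λ ()) ∷ []) ∷ [] ∷ []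

  ∈-states : ∀ s → s ∈ₗ states
  ∈-states (false , false) = here refl
  ∈-states (false , true)  = there (here refl)
  ∈-states (true , false)  = there (there (here refl))
  ∈-states (true , true)   = there (there (there (here refl)))

  -- T (walk R s t w): reading w from state s (the last two letters read), every window (a , b , c)
  -- satisfies R a b c, and the final state is t.
  walk : ∀ {j} → Rule → State → State → Vec Bool j → Bool
  walk R s       t []      = ⌊ s ≟ₛ t ⌋
  walk R (a , b) t (c ∷ w) = R a b c ∧ walk R (b , c) t w

  walks : Rule → State → State → ℕ → ℕ
  walks R s       t zero    = 𝟙 ⌊ s ≟ₛ t ⌋
  walks R (a , b) t (suc j) = 𝟙 (R a b true) * walks R (b , true) t j + 𝟙 (R a b false) * walks R (b , false) t j

  ∑-walk : ∀ R s t j → ∑ (𝟙 ∘ walk R s t) (allSubsets j) ≡ walks R s t j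
  ∑-walk R s t zero = ℕP.+-identityʳ _
  ∑-walk R (a , b) t (suc j) = begin
    ∑ (𝟙 ∘ walk R (a , b) t) (map (true ∷_) (allSubsets j) ++ map (false ∷_) (allSubsets j))
      ≡⟨ ∑-++ _ (map (true ∷_) (allSubsets j)) _ ⟩
    ∑ (𝟙 ∘ walk R (a , b) t) (map (true ∷_) (allSubsets j)) + ∑ (𝟙 ∘ walk R (a , b) t) (map (false ∷_) (allSubsets j))
      ≡⟨ cong₂ _+_ (extend true) (extend false) ⟩
    walks R (a , b) t (suc j) ∎
    where
    open ≡-Reasoning
    extend : ∀ c → ∑ (𝟙 ∘ walk R (a , b) t) (map (c ∷_) (allSubsets j)) ≡ 𝟙 (R a b c) * walks R (b , c) t j
    extend c = begin
      ∑ (𝟙 ∘ walk R (a , b) t) (map (c ∷_) (allSubsets j))            ≡⟨ ∑-map _ (c ∷_) (allSubsets j) ⟩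
      ∑ (λ w → 𝟙 (R a b c ∧ walk R (b , c) t w)) (allSubsets j)        ≡⟨ ∑-cong (λ w → 𝟙-∧ (R a b c) _) (allSubsets j) ⟩
      ∑ (λ w → 𝟙 (R a b c) * 𝟙 (walk R (b , c) t w)) (allSubsets j)   ≡⟨ ∑-*ˡ (𝟙 (R a b c)) _ (allSubsets j) ⟩
      𝟙 (R a b c) * ∑ (𝟙 ∘ walk R (b , c) t) (allSubsets j)           ≡⟨ cong (𝟙 (R a b c) *_) (∑-walk R (b , c) t j) ⟩
      𝟙 (R a b c) * walks R (b , c) t j                                ∎

  lastTwo : Vec Bool (2 + k) → State
  lastTwo F = lookup F (prev (prev zero)) , lookup F (prev zero)

  module _ (R : Rule) where

    walk⇒lastTwo : ∀ {k} s t (w : Vec Bool (2 + k)) → T (walk R s t w) → t ≡ lastTwo w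
    walk⇒lastTwo (a , b) t (c ∷ d ∷ []) ok =
      sym (toWitness {a? = (c , d) ≟ₛ t} (proj₂ (Equivalence.to (T-∧ {R b c d}) (proj₂ (Equivalence.to (T-∧ {R a b c}) ok)))))
    walk⇒lastTwo (a , b) t (c ∷ d ∷ e ∷ w) ok =
      walk⇒lastTwo (b , c) t (d ∷ e ∷ w) (proj₂ (Equivalence.to (T-∧ {R a b c}) ok))

    -- the windows of the word a b w that end inside w
    Windows : ∀ {j} → Bool → Bool → Vec Bool j → Set
    Windows a b w = ∀ u → T (R (lookup (a ∷ b ∷ w) (inject₁ (inject₁ u))) (lookup (b ∷ w) (inject₁ u)) (lookup w u))

    walk⇒Windows : ∀ {j} a b t (w : Vec Bool j) → T (walk R (a , b) t w) → Windows a b w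
    walk⇒Windows a b t (c ∷ w) ok zero    = proj₁ (Equivalence.to (T-∧ {R a b c}) ok)
    walk⇒Windows a b t (c ∷ w) ok (suc u) = walk⇒Windows b c t w (proj₂ (Equivalence.to (T-∧ {R a b c}) ok)) u

    Windows⇒walk : ∀ {k} a b (w : Vec Bool (2 + k)) → Windows a b w → T (walk R (a , b) (lastTwo w) w)
    Windows⇒walk a b (c ∷ d ∷ []) ok =
      Equivalence.from (T-∧ {R a b c})
        (ok zero , Equivalence.from (T-∧ {R b c d}) (ok (suc zero) , fromWitness {a? = (c , d) ≟ₛ (c , d)} refl))
    Windows⇒walk a b (c ∷ d ∷ e ∷ w) ok =
      Equivalence.from (T-∧ {R a b c}) (ok zero , Windows⇒walk b c (d ∷ e ∷ w) (ok ∘ suc))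

    -- On a cycle, the windows ending at the vertices are those of F preceded by its last two letters.
    Satisfies⇔Windows : ∀ {k} (F : Vec Bool (2 + k)) → Satisfies R F ⇔ Windows (proj₁ (lastTwo F)) (proj₂ (lastTwo F)) F
    Satisfies⇔Windows F = mk⇔
      (λ sat u → subst T (window-ending-at u)
                   (subst (λ x → T (R (lookup F (prev (prev u))) (lookup F (prev u)) (lookup F x))) (next-prev u) (sat (prev u))))
      (λ win v → subst (λ x → T (R (lookup F (prev x)) (lookup F x) (lookup F (next v)))) (prev-next v)
                   (subst T (sym (window-ending-at (next v))) (win (next v))))
      where
      window-ending-at : ∀ u → R (lookup F (prev (prev u))) (lookup F (prev u)) (lookup F u)
                             ≡ R (lookup (proj₁ (lastTwo F) ∷ proj₂ (lastTwo F) ∷ F) (inject₁ (inject₁ u)))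
                                 (lookup (proj₂ (lastTwo F) ∷ F) (inject₁ u)) (lookup F u)
      window-ending-at zero          = refl
      window-ending-at (suc zero)    = refl
      window-ending-at (suc (suc u)) = refl

    Satisfies⇔walk : ∀ {k} (F : Vec Bool (2 + k)) → Satisfies R F ⇔ T (walk R (lastTwo F) (lastTwo F) F)
    Satisfies⇔walk F = mk⇔
      (Windows⇒walk _ _ F ∘ Equivalence.to (Satisfies⇔Windows F))
      (Equivalence.from (Satisfies⇔Windows F) ∘ walk⇒Windows _ _ _ F)

    -- Only the state s = lastTwo F can start and end a walk along F.
    𝟙-walk-diagonal : ∀ {k} (F : Vec Bool (2 + k)) → 𝟙 (walk R (lastTwo F) (lastTwo F) F) ≡ ∑ (λ s → 𝟙 (walk R s s F)) states
    𝟙-walk-diagonal F = sym (∑-pointMass states-unique (∈-states (lastTwo F)) off)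
      where
      off : ∀ s → s ≢ lastTwo F → 𝟙 (walk R s s F) ≡ 0
      off s s≢ = cong 𝟙 (¬-not (s≢ ∘ walk⇒lastTwo s s F ∘ Equivalence.from T-≡))

    count-cyclic : ∀ k → ∑ (λ F → 𝟙 (walk R (lastTwo F) (lastTwo F) F)) (allSubsets (2 + k))
                         ≡ ∑ (λ s → walks R s s (2 + k)) states
    count-cyclic k = begin
      ∑ (λ F → 𝟙 (walk R (lastTwo F) (lastTwo F) F)) (allSubsets (2 + k))
        ≡⟨ ∑-cong 𝟙-walk-diagonal (allSubsets (2 + k)) ⟩
      ∑ (λ F → ∑ (λ s → 𝟙 (walk R s s F)) states) (allSubsets (2 + k))
        ≡⟨ ∑-swap (λ F s → 𝟙 (walk R s s F)) (allSubsets (2 + k)) states ⟩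
      ∑ (λ s → ∑ (𝟙 ∘ walk R s s) (allSubsets (2 + k))) states
        ≡⟨ ∑-cong (λ s → ∑-walk R s s (2 + k)) states ⟩
      ∑ (λ s → walks R s s (2 + k)) states ∎
      where open ≡-Reasoning

  -- Minimal forts are counted by Perrin numbers

  nand : Rule
  nand a b c = ⌊ b Bool.≟ not (a ∧ c) ⌋

  nand-walks : State → ℕ → ℕ
  nand-walks = walks nand (false , true)

  -- From the state 01 the next letter is free; 0 forces 1 (back to 01), while 1 forces 0 and then 1.
  nand-walks-rec : ∀ t j → nand-walks t (3 + j) ≡ nand-walks t (1 + j) + nand-walks t j
  nand-walks-rec t j = shape (nand-walks t (1 + j)) (nand-walks t j)
    where
    shape : ∀ a b → ((((b + 0) + 0) + 0) + 0) + (((a + 0) + 0) + 0) ≡ a + b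
    shape = solve-∀

  -- No walk leaves 00, and 10 and 11 are forced into 01 after one and two letters.
  nandTrace : ℕ → ℕ
  nandTrace k = nand-walks (false , true) (2 + k) + nand-walks (true , false) (1 + k) + nand-walks (true , true) k

  nand-trace : ∀ k → ∑ (λ s → walks nand s s (2 + k)) states ≡ nandTrace k
  nand-trace k = shape (nand-walks (false , true) (2 + k)) (nand-walks (true , false) (1 + k)) (nand-walks (true , true) k)
    where
    shape : ∀ a b c → a + (((b + 0) + 0) + ((((c + 0) + 0) + 0) + 0)) ≡ a + b + c
    shape = solve-∀

  nandTrace-rec : ∀ k → nandTrace (3 + k) ≡ nandTrace (1 + k) + nandTrace k
  nandTrace-rec k = begin
    nandTrace (3 + k)
      ≡⟨ cong₂ _+_ (cong₂ _+_ (nand-walks-rec _ (2 + k)) (nand-walks-rec _ (1 + k))) (nand-walks-rec _ k) ⟩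
    (a₁ + a₀) + (b₁ + b₀) + (c₁ + c₀)
      ≡⟨ shape a₁ a₀ b₁ b₀ c₁ c₀ ⟩
    nandTrace (1 + k) + nandTrace k ∎
    where
    open ≡-Reasoning
    a₁ a₀ b₁ b₀ c₁ c₀ : ℕ
    a₁ = nand-walks (false , true) (3 + k)
    a₀ = nand-walks (false , true) (2 + k)
    b₁ = nand-walks (true , false) (2 + k)
    b₀ = nand-walks (true , false) (1 + k)
    c₁ = nand-walks (true , true) (1 + k)
    c₀ = nand-walks (true , true) k
    shape : ∀ a₁ a₀ b₁ b₀ c₁ c₀ → (a₁ + a₀) + (b₁ + b₀) + (c₁ + c₀) ≡ (a₁ + b₁ + c₁) + (a₀ + b₀ + c₀)
    shape = solve-∀

  nandTrace≡perrin : ∀ k → nandTrace k ≡ perrin (2 + k)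
  nandTrace≡perrin 0 = refl
  nandTrace≡perrin 1 = refl
  nandTrace≡perrin 2 = refl
  nandTrace≡perrin (suc (suc (suc k))) =
    trans (nandTrace-rec k) (cong₂ _+_ (nandTrace≡perrin (suc k)) (nandTrace≡perrin k))

  NandCycle⇔Satisfies : (F : Subset (suc m)) → NandCycle F ⇔ Satisfies nand F
  NandCycle⇔Satisfies F = mk⇔
    (λ nand-eq v → fromWitness (nand-eq v))
    (λ sat v → toWitness {a? = _ Bool.≟ _} (sat v))

  minimalFort⇔walk : ∀ {k} (F : Subset (3 + k)) → MinimalFort (3 + k) F ⇔ T (walk nand (lastTwo F) (lastTwo F) F)
  minimalFort⇔walk F = mk⇔
    (Equivalence.to (Satisfies⇔walk nand F) ∘ Equivalence.to (NandCycle⇔Satisfies F) ∘ minimalFort⇒NandCycle)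
    (NandCycle⇒minimalFort ∘ Equivalence.from (NandCycle⇔Satisfies F) ∘ Equivalence.from (Satisfies⇔walk nand F))

  numMinForts≡perrin : ∀ k → numMinForts (3 + k) ≡ perrin (3 + k)
  numMinForts≡perrin k = begin
    numMinForts (3 + k)
      ≡⟨ length-filter≡∑ (minimalFort? (3 + k)) (allSubsets (3 + k)) ⟩
    ∑ (𝟙 ∘ does ∘ minimalFort? (3 + k)) (allSubsets (3 + k))
      ≡⟨ ∑-cong (λ F → cong 𝟙 (does-⇔ (minimalFort⇔walk F) (minimalFort? _ F) (T? _))) (allSubsets (3 + k)) ⟩
    ∑ (λ F → 𝟙 (walk nand (lastTwo F) (lastTwo F) F)) (allSubsets (3 + k))
      ≡⟨ count-cyclic nand (suc k) ⟩
    ∑ (λ s → walks nand s s (3 + k)) states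
      ≡⟨ nand-trace (suc k) ⟩
    nandTrace (suc k)
      ≡⟨ nandTrace≡perrin (suc k) ⟩
    perrin (3 + k) ∎
    where open ≡-Reasoning

module PsiApproximation where

  open import Data.Integer as ℤ using (+_)
  import Data.Integer.Properties as ℤP
  open import Data.Product using (_×_; _,_; proj₁; proj₂; ∃-syntax)
  open import Data.Rational as ℚ using (mkℚ; _+_; _*_; _-_; -_; _≤_; _<_; 0ℚ; 1ℚ; ½; ∣_∣; _/_)
  import Data.Rational.Properties as ℚP
  open import Algebra.Properties.Group ℚP.+-0-group using (⁻¹-involutive)
  import Data.Rational.Unnormalised as ℚᵘ
  import Data.Rational.Unnormalised.Properties as ℚᵘP
  open import Data.Sum using (inj₁; inj₂)
  open import Function using (_∘_)
  open import Level using (0ℓ)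
  open import Relation.Nullary using (¬_; yes; no; contradiction)
  open import Relation.Nullary.Decidable using (True; toWitness; dec⇒maybe; _×-dec_)
  open import Relation.Unary using (Decidable)
  open import Tactic.RingSolver using (solve-∀)
  open import Tactic.RingSolver.Core.AlmostCommutativeRing using (AlmostCommutativeRing; fromCommutativeRing)
  open Perrin

  ℚ-ring : AlmostCommutativeRing 0ℓ 0ℓ
  ℚ-ring = fromCommutativeRing ℚP.+-*-commutativeRing (λ x → dec⇒maybe (0ℚ ℚP.≟ x))

  ≤-eval : ∀ {p q} {_ : True (p ℚP.≤? q)} → p ≤ q
  ≤-eval {_} {_} {p≤q} = toWitness p≤q

  <-eval : ∀ {p q} {_ : True (p ℚP.<? q)} → p < q
  <-eval {_} {_} {p<q} = toWitness p<q

  p+[q-p]≡q : ∀ p q → p + (q - p) ≡ q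
  p+[q-p]≡q = solve-∀ ℚ-ring

  [p+q]-p≡q : ∀ p q → (p + q) - p ≡ q
  [p+q]-p≡q = solve-∀ ℚ-ring

  0≤q-p⇒p≤q : ∀ {p q} → 0ℚ ≤ q - p → p ≤ q
  0≤q-p⇒p≤q {p} {q} 0≤q-p = subst₂ _≤_ (ℚP.+-identityʳ p) (p+[q-p]≡q p q) (ℚP.+-monoʳ-≤ p 0≤q-p)

  0<q-p⇒p<q : ∀ {p q} → 0ℚ < q - p → p < q
  0<q-p⇒p<q {p} {q} 0<q-p = subst₂ _<_ (ℚP.+-identityʳ p) (p+[q-p]≡q p q) (ℚP.+-monoʳ-< p 0<q-p)

  p≤q⇒0≤q-p : ∀ {p q} → p ≤ q → 0ℚ ≤ q - p
  p≤q⇒0≤q-p {p} {q} p≤q = subst (_≤ q - p) (ℚP.+-inverseʳ p) (ℚP.+-monoˡ-≤ (- p) p≤q)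

  p<q⇒0<q-p : ∀ {p q} → p < q → 0ℚ < q - p
  p<q⇒0<q-p {p} {q} p<q = subst (_< q - p) (ℚP.+-inverseʳ p) (ℚP.+-monoˡ-< (- p) p<q)

  ≤-byDiff : ∀ {p q} d → q - p ≡ d → 0ℚ ≤ d → p ≤ q
  ≤-byDiff d q-p≡d 0≤d = 0≤q-p⇒p≤q (subst (0ℚ ≤_) (sym q-p≡d) 0≤d)

  <-byDiff : ∀ {p q} d → q - p ≡ d → 0ℚ < d → p < q
  <-byDiff d q-p≡d 0<d = 0<q-p⇒p<q (subst (0ℚ <_) (sym q-p≡d) 0<d)

  +-nonNeg : ∀ {p q} → 0ℚ ≤ p → 0ℚ ≤ q → 0ℚ ≤ p + q
  +-nonNeg = ℚP.+-mono-≤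

  nonNeg+pos : ∀ {p q} → 0ℚ ≤ p → 0ℚ < q → 0ℚ < p + q
  nonNeg+pos = ℚP.+-mono-≤-<

  *-nonNeg : ∀ {p q} → 0ℚ ≤ p → 0ℚ ≤ q → 0ℚ ≤ p * q
  *-nonNeg {p} {q} 0≤p 0≤q = subst (_≤ p * q) (ℚP.*-zeroˡ q) (ℚP.*-monoʳ-≤-nonNeg q {{ℚ.nonNegative 0≤q}} 0≤p)

  *-pos : ∀ {p q} → 0ℚ < p → 0ℚ < q → 0ℚ < p * q
  *-pos {p} {q} 0<p 0<q = subst (_< p * q) (ℚP.*-zeroˡ q) (ℚP.*-monoˡ-<-pos q {{ℚ.positive 0<q}} 0<p)

  square-nonNeg : ∀ p → 0ℚ ≤ p * p
  square-nonNeg p with ℚP.≤-total 0ℚ p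
  ... | inj₁ 0≤p = *-nonNeg 0≤p 0≤p
  ... | inj₂ p≤0 = subst (0ℚ ≤_) (neg*neg p) (*-nonNeg (ℚP.neg-antimono-≤ p≤0) (ℚP.neg-antimono-≤ p≤0))
    where
    neg*neg : ∀ p → (- p) * (- p) ≡ p * p
    neg*neg = solve-∀ ℚ-ring

  *-monoˡ-≤ : ∀ r {p q} → 0ℚ ≤ r → p ≤ q → r * p ≤ r * q
  *-monoˡ-≤ r 0≤r = ℚP.*-monoˡ-≤-nonNeg r {{ℚ.nonNegative 0≤r}}

  *-mono-≤ : ∀ {p q r s} → 0ℚ ≤ p → 0ℚ ≤ r → p ≤ q → r ≤ s → p * r ≤ q * s
  *-mono-≤ {p} {q} {r} {s} 0≤p 0≤r p≤q r≤s =
    ℚP.≤-trans (ℚP.*-monoʳ-≤-nonNeg r {{ℚ.nonNegative 0≤r}} p≤q) (*-monoˡ-≤ q (ℚP.≤-trans 0≤p p≤q) r≤s)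

  p≤∣p∣ : ∀ p → p ≤ ∣ p ∣
  p≤∣p∣ p with ℚP.≤-total 0ℚ p
  ... | inj₁ 0≤p = ℚP.≤-reflexive (sym (ℚP.0≤p⇒∣p∣≡p 0≤p))
  ... | inj₂ p≤0 = ℚP.≤-trans p≤0 (ℚP.0≤∣p∣ p)

  -∣p∣≤p : ∀ p → - ∣ p ∣ ≤ p
  -∣p∣≤p p = subst₂ _≤_ (cong -_ (ℚP.∣-p∣≡∣p∣ p)) (⁻¹-involutive p) (ℚP.neg-antimono-≤ (p≤∣p∣ (- p)))

  ∣p∣≤q : ∀ {p q} → - q ≤ p → p ≤ q → ∣ p ∣ ≤ q
  ∣p∣≤q {p} {q} -q≤p p≤q with ℚP.∣p∣≡p∨∣p∣≡-p p
  ... | inj₁ ∣p∣≡p  = subst (_≤ q) (sym ∣p∣≡p) p≤q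
  ... | inj₂ ∣p∣≡-p = subst (_≤ q) (sym ∣p∣≡-p) (subst (- p ≤_) (⁻¹-involutive q) (ℚP.neg-antimono-≤ -q≤p))

  ∣p∣<q⇒ : ∀ {p q} → ∣ p ∣ < q → - q < p × p < q
  ∣p∣<q⇒ {p} ∣p∣<q = ℚP.<-≤-trans (ℚP.neg-antimono-< ∣p∣<q) (-∣p∣≤p p) , ℚP.≤-<-trans (p≤∣p∣ p) ∣p∣<q

  ∣*∣-≤ : ∀ {p q a b} → ∣ p ∣ ≤ a → ∣ q ∣ ≤ b → ∣ p * q ∣ ≤ a * b
  ∣*∣-≤ {p} {q} ∣p∣≤a ∣q∣≤b =
    subst (_≤ _) (sym (ℚP.∣p*q∣≡∣p∣*∣q∣ p q)) (*-mono-≤ (ℚP.0≤∣p∣ p) (ℚP.0≤∣p∣ q) ∣p∣≤a ∣q∣≤b)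

  ∣a-b∣<½⇒ : ∀ {a b} → ∣ a - b ∣ < ½ → a - ½ < b × b < a + ½
  ∣a-b∣<½⇒ {a} {b} ∣a-b∣<½ =
    <-byDiff (½ - (a - b)) (shift₁ a b) (p<q⇒0<q-p (proj₂ (∣p∣<q⇒ ∣a-b∣<½))) ,
    <-byDiff ((a - b) - (- ½)) (shift₂ a b) (p<q⇒0<q-p (proj₁ (∣p∣<q⇒ ∣a-b∣<½)))
    where
    shift₁ : ∀ a b → b - (a - ½) ≡ ½ - (a - b)
    shift₁ = solve-∀ ℚ-ring
    shift₂ : ∀ a b → (a + ½) - b ≡ (a - b) - (- ½)
    shift₂ = solve-∀ ℚ-ring

  square<¼⇒∣∣<½ : ∀ q → q * q < 1 / 4 → ∣ q ∣ < ½
  square<¼⇒∣∣<½ q q²<¼ = ℚP.≰⇒> λ ½≤∣q∣ → ℚP.<-irrefl refl (ℚP.<-≤-trans q²<¼ (begin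
    1 / 4           ≤⟨ *-mono-≤ ≤-eval ≤-eval ½≤∣q∣ ½≤∣q∣ ⟩
    ∣ q ∣ * ∣ q ∣   ≡⟨ sym (ℚP.∣p*q∣≡∣p∣*∣q∣ q q) ⟩
    ∣ q * q ∣       ≡⟨ ℚP.0≤p⇒∣p∣≡p (square-nonNeg q) ⟩
    q * q           ∎))
    where open ℚP.≤-Reasoning

  pow-nonNeg : ∀ n {p} → 0ℚ ≤ p → 0ℚ ≤ powℚ p n
  pow-nonNeg zero    0≤p = ≤-eval
  pow-nonNeg (suc n) 0≤p = *-nonNeg 0≤p (pow-nonNeg n 0≤p)

  pow-pos : ∀ n {p} → 0ℚ < p → 0ℚ < powℚ p n
  pow-pos zero    0<p = <-eval
  pow-pos (suc n) 0<p = *-pos 0<p (pow-pos n 0<p)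

  pow-mono-≤ : ∀ n {p q} → 0ℚ ≤ p → p ≤ q → powℚ p n ≤ powℚ q n
  pow-mono-≤ zero    0≤p p≤q = ℚP.≤-refl
  pow-mono-≤ (suc n) 0≤p p≤q = *-mono-≤ 0≤p (pow-nonNeg n 0≤p) p≤q (pow-mono-≤ n 0≤p p≤q)

  pow-antitoneʳ : ∀ {c} → 0ℚ ≤ c → c ≤ 1ℚ → ∀ {m n} → m ℕ.≤ n → powℚ c n ≤ powℚ c m
  pow-antitoneʳ {c} 0≤c c≤1 m≤n = go (ℕP.≤⇒≤′ m≤n)
    where
    go : ∀ {m n} → m ℕ.≤′ n → powℚ c n ≤ powℚ c m
    go ℕ.≤′-refl           = ℚP.≤-refl
    go (ℕ.≤′-step {n} m≤n) = ℚP.≤-trans (subst (c * powℚ c n ≤_) (ℚP.*-identityˡ (powℚ c n))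
                                            (ℚP.*-monoʳ-≤-nonNeg (powℚ c n) {{ℚ.nonNegative (pow-nonNeg n 0≤c)}} c≤1))
                                       (go m≤n)

  pow-monotoneʳ : ∀ {c} → 1ℚ ≤ c → ∀ {m n} → m ℕ.≤ n → powℚ c m ≤ powℚ c n
  pow-monotoneʳ {c} 1≤c m≤n = go (ℕP.≤⇒≤′ m≤n)
    where
    go : ∀ {m n} → m ℕ.≤′ n → powℚ c m ≤ powℚ c n
    go ℕ.≤′-refl           = ℚP.≤-refl
    go (ℕ.≤′-step {n} m≤n) = ℚP.≤-trans (go m≤n) (subst (_≤ c * powℚ c n) (ℚP.*-identityˡ (powℚ c n))
                                            (ℚP.*-monoʳ-≤-nonNeg (powℚ c n) {{ℚ.nonNegative (pow-nonNeg n (ℚP.≤-trans ≤-eval 1≤c))}} 1≤c))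

  pow-*-distrib : ∀ p q n → powℚ p n * powℚ q n ≡ powℚ (p * q) n
  pow-*-distrib p q zero    = refl
  pow-*-distrib p q (suc n) = trans (interchange p (powℚ p n) q (powℚ q n)) (cong ((p * q) *_) (pow-*-distrib p q n))
    where
    interchange : ∀ a x b y → (a * x) * (b * y) ≡ (a * b) * (x * y)
    interchange = solve-∀ ℚ-ring

  toℚᵘ-ℕtoℚ : ∀ m → ℚ.toℚᵘ (ℕtoℚ m) ℚᵘ.≃ ℚᵘ.mkℚᵘ (+ m) 0
  toℚᵘ-ℕtoℚ m = ℚP.toℚᵘ-fromℚᵘ (ℚᵘ.mkℚᵘ (+ m) 0)

  ℕtoℚ-+ : ∀ a b → ℕtoℚ (a ℕ.+ b) ≡ ℕtoℚ a + ℕtoℚ b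
  ℕtoℚ-+ a b = ℚP.toℚᵘ-injective (begin
    ℚ.toℚᵘ (ℕtoℚ (a ℕ.+ b))                ≈⟨ toℚᵘ-ℕtoℚ (a ℕ.+ b) ⟩
    ℚᵘ.mkℚᵘ (+ (a ℕ.+ b)) 0                 ≈⟨ ℚᵘ.*≡* (cong (ℤ._* + 1) (trans (ℤP.pos-+ a b) (sym (cong₂ ℤ._+_ (ℤP.*-identityʳ (+ a)) (ℤP.*-identityʳ (+ b)))))) ⟩
    ℚᵘ.mkℚᵘ (+ a) 0 ℚᵘ.+ ℚᵘ.mkℚᵘ (+ b) 0    ≈⟨ ℚᵘP.+-cong (ℚᵘP.≃-sym (toℚᵘ-ℕtoℚ a)) (ℚᵘP.≃-sym (toℚᵘ-ℕtoℚ b)) ⟩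
    ℚ.toℚᵘ (ℕtoℚ a) ℚᵘ.+ ℚ.toℚᵘ (ℕtoℚ b)    ≈⟨ ℚᵘP.≃-sym (ℚP.toℚᵘ-homo-+ (ℕtoℚ a) (ℕtoℚ b)) ⟩
    ℚ.toℚᵘ (ℕtoℚ a + ℕtoℚ b)                ∎)
    where open ℚᵘP.≃-Reasoning

  ℕtoℚ-* : ∀ a b → ℕtoℚ (a ℕ.* b) ≡ ℕtoℚ a * ℕtoℚ b
  ℕtoℚ-* a b = ℚP.toℚᵘ-injective (begin
    ℚ.toℚᵘ (ℕtoℚ (a ℕ.* b))                ≈⟨ toℚᵘ-ℕtoℚ (a ℕ.* b) ⟩
    ℚᵘ.mkℚᵘ (+ (a ℕ.* b)) 0                 ≈⟨ ℚᵘ.*≡* (cong (ℤ._* + 1) (ℤP.pos-* a b)) ⟩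
    ℚᵘ.mkℚᵘ (+ a) 0 ℚᵘ.* ℚᵘ.mkℚᵘ (+ b) 0    ≈⟨ ℚᵘP.*-cong (ℚᵘP.≃-sym (toℚᵘ-ℕtoℚ a)) (ℚᵘP.≃-sym (toℚᵘ-ℕtoℚ b)) ⟩
    ℚ.toℚᵘ (ℕtoℚ a) ℚᵘ.* ℚ.toℚᵘ (ℕtoℚ b)    ≈⟨ ℚᵘP.≃-sym (ℚP.toℚᵘ-homo-* (ℕtoℚ a) (ℕtoℚ b)) ⟩
    ℚ.toℚᵘ (ℕtoℚ a * ℕtoℚ b)                ∎)
    where open ℚᵘP.≃-Reasoning

  ℕtoℚ-nonNeg : ∀ m → 0ℚ ≤ ℕtoℚ m
  ℕtoℚ-nonNeg m = ℚP.nonNegative⁻¹ _ {{ℚP.normalize-nonNeg m 1}}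

  ℕtoℚ-mono-≤ : ∀ {a b} → a ℕ.≤ b → ℕtoℚ a ≤ ℕtoℚ b
  ℕtoℚ-mono-≤ {a} a≤b with ℕP.m≤n⇒∃[o]m+o≡n a≤b
  ... | o , refl = ≤-byDiff (ℕtoℚ o) (trans (cong (_- ℕtoℚ a) (ℕtoℚ-+ a o)) ([p+q]-p≡q (ℕtoℚ a) (ℕtoℚ o))) (ℕtoℚ-nonNeg o)

  ratioℕ-* : ∀ a {b} → 1 ℕ.≤ b → ratioℕ a b * ℕtoℚ b ≡ ℕtoℚ a
  ratioℕ-* a {suc m} _ = ℚP.toℚᵘ-injective (begin
    ℚ.toℚᵘ (ratioℕ a (suc m) * ℕtoℚ (suc m))             ≈⟨ ℚP.toℚᵘ-homo-* (ratioℕ a (suc m)) (ℕtoℚ (suc m)) ⟩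
    ℚ.toℚᵘ (ratioℕ a (suc m)) ℚᵘ.* ℚ.toℚᵘ (ℕtoℚ (suc m))  ≈⟨ ℚᵘP.*-cong (ℚP.toℚᵘ-fromℚᵘ (ℚᵘ.mkℚᵘ (+ a) m)) (toℚᵘ-ℕtoℚ (suc m)) ⟩
    ℚᵘ.mkℚᵘ (+ a) m ℚᵘ.* ℚᵘ.mkℚᵘ (+ suc m) 0              ≈⟨ ℚᵘ.*≡* cancel ⟩
    ℚᵘ.mkℚᵘ (+ a) 0                                        ≈⟨ ℚᵘP.≃-sym (toℚᵘ-ℕtoℚ a) ⟩
    ℚ.toℚᵘ (ℕtoℚ a)                                        ∎)
    where
    open ℚᵘP.≃-Reasoning
    cancel : (+ a ℤ.* + suc m) ℤ.* + 1 ≡ + a ℤ.* + suc (m ℕ.* 1)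
    cancel = trans (ℤP.*-identityʳ _) (cong (λ k → + a ℤ.* + suc k) (sym (ℕP.*-identityʳ m)))

  -- the denominator of ε works, since ε times it is the (positive) numerator
  archimedean : ∀ {ε} → 0ℚ < ε → ∃[ b ] 1ℚ ≤ ε * ℕtoℚ b
  archimedean {ε@(mkℚ (+ suc a) d _)} 0<ε =
    suc d , subst (1ℚ ≤_) (sym (trans (cong (_* ℕtoℚ (suc d)) (sym (ℚP.↥p/↧p≡p ε))) (ratioℕ-* (suc a) (ℕ.s≤s ℕ.z≤n))))
                  (ℕtoℚ-mono-≤ {1} {suc a} (ℕ.s≤s ℕ.z≤n))
  archimedean {mkℚ (+ zero) _ _} (ℚ.*<* 0<0) = contradiction 0<0 (ℤP.<-irrefl refl)
  archimedean {mkℚ ℤ.-[1+ _ ] _ _} (ℚ.*<* ())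

  -- The plastic polynomial near ψ

  private
    p : ℚ → ℚ
    p = plasticPoly

  -- completing the square in p z - p y = (z - y) (z² + z y + y² - 1)
  plasticPoly-factor : ∀ y z → (z * z * z - z - 1ℚ) - (y * y * y - y - 1ℚ)
                               ≡ (z - y) * ((y + ½ * z) * (y + ½ * z) + 3 / 4 * (z * z - 36 / 25) + 2 / 25)
  plasticPoly-factor = solve-∀ ℚ-ring

  plasticPoly-slope-pos : ∀ {y z} → 6 / 5 ≤ z → 0ℚ < (y + ½ * z) * (y + ½ * z) + 3 / 4 * (z * z - 36 / 25) + 2 / 25
  plasticPoly-slope-pos {y} {z} 6/5≤z =
    nonNeg+pos (+-nonNeg (square-nonNeg (y + ½ * z)) (*-nonNeg {3 / 4} ≤-eval (p≤q⇒0≤q-p (*-mono-≤ ≤-eval ≤-eval 6/5≤z 6/5≤z))))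
               <-eval

  plasticPoly-increasing : ∀ {y z} → 6 / 5 ≤ z → y < z → p y < p z
  plasticPoly-increasing {y} {z} 6/5≤z y<z =
    <-byDiff _ (plasticPoly-factor y z) (*-pos (p<q⇒0<q-p y<z) (plasticPoly-slope-pos {y} 6/5≤z))

  plasticPoly-monotone : ∀ {y z} → 6 / 5 ≤ z → y ≤ z → p y ≤ p z
  plasticPoly-monotone {y} {z} 6/5≤z y≤z =
    ≤-byDiff _ (plasticPoly-factor y z) (*-nonNeg (p≤q⇒0≤q-p y≤z) (ℚP.<⇒≤ (plasticPoly-slope-pos {y} 6/5≤z)))

  plasticPoly-lipschitz : ∀ {y z} → 0ℚ ≤ y → y ≤ 4 / 3 → y ≤ z → z ≤ 7 / 3 → p z - p y ≤ 10 * (z - y)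
  plasticPoly-lipschitz {y} {z} 0≤y y≤4/3 y≤z z≤7/3 = begin
    p z - p y                                ≡⟨ factor y z ⟩
    (z - y) * (z * z + z * y + y * y - 1ℚ)   ≤⟨ *-monoˡ-≤ (z - y) (p≤q⇒0≤q-p y≤z) slope≤10 ⟩
    (z - y) * 10                             ≡⟨ ℚP.*-comm (z - y) 10 ⟩
    10 * (z - y)                             ∎
    where
    open ℚP.≤-Reasoning
    factor : ∀ y z → (z * z * z - z - 1ℚ) - (y * y * y - y - 1ℚ) ≡ (z - y) * (z * z + z * y + y * y - 1ℚ)
    factor = solve-∀ ℚ-ring
    0≤z : 0ℚ ≤ z
    0≤z = ℚP.≤-trans 0≤y y≤z
    slope≤10 : z * z + z * y + y * y - 1ℚ ≤ 10
    slope≤10 = ℚP.≤-trans (ℚP.+-monoˡ-≤ (- 1ℚ) (ℚP.+-mono-≤ (ℚP.+-mono-≤ (*-mono-≤ 0≤z 0≤z z≤7/3 z≤7/3) (*-mono-≤ 0≤z 0≤y z≤7/3 y≤4/3))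
                                                             (*-mono-≤ 0≤y 0≤y y≤4/3 y≤4/3)))
                          ≤-eval

  below-root⇒<4/3 : ∀ {x} → 6 / 5 ≤ x → p x < 0ℚ → x < 4 / 3
  below-root⇒<4/3 {x} 6/5≤x px<0 = ℚP.≰⇒> λ 4/3≤x →
    ℚP.<-irrefl refl (ℚP.<-≤-trans (ℚP.<-trans px<0 (<-eval {0ℚ} {p (4 / 3)})) (plasticPoly-monotone 6/5≤x 4/3≤x))

  near-root : ∀ {x} → 6 / 5 ≤ x → ∣ p x ∣ ≤ 1 / 10000 → 33 / 25 ≤ x × x ≤ 13249 / 10000
  near-root {x} 6/5≤x ∣px∣≤ = ℚP.≮⇒≥ too-small , ℚP.≮⇒≥ too-large
    where
    too-small : ¬ x < 33 / 25
    too-small x< = ℚP.<-irrefl refl (ℚP.<-≤-trans (ℚP.<-trans (plasticPoly-increasing ≤-eval x<) (<-eval {p (33 / 25)} { - (1 / 10000)}))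
                                                  (ℚP.≤-trans (ℚP.neg-antimono-≤ ∣px∣≤) (-∣p∣≤p (p x))))
    too-large : ¬ 13249 / 10000 < x
    too-large <x = ℚP.<-irrefl refl (ℚP.<-≤-trans (ℚP.<-trans (<-eval {1 / 10000} {p (13249 / 10000)}) (plasticPoly-increasing 6/5≤x <x))
                                                  (ℚP.≤-trans (p≤∣p∣ (p x)) ∣px∣≤))

  bisect : ∀ {ℓ} (P : ℚ → Set ℓ) → Decidable P → ∀ {a} h → P a → ¬ P (a + h) →
           ∀ k → ∃[ x ] P x × ¬ P (x + h * powℚ ½ k)
  bisect P P? {a} h Pa ¬P[a+h] zero = a , Pa , ¬P[a+h] ∘ subst P (cong (λ t → a + t) (ℚP.*-identityʳ h))
  bisect P P? h Pa ¬P[a+h] (suc k) with bisect P P? h Pa ¬P[a+h] k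
  ... | x , Px , ¬P[x+w] with P? (x + h * powℚ ½ (suc k))
  ...   | yes Pm = _ , Pm , ¬P[x+w] ∘ subst P (halves x h (powℚ ½ k))
    where
    halves : ∀ x h w → (x + h * (½ * w)) + h * (½ * w) ≡ x + h * w
    halves = solve-∀ ℚ-ring
  ...   | no ¬Pm = x , Px , ¬Pm

  record Bracket (k : ℕ) : Set where
    field
      lower        : ℚ
      6/5≤lower    : 6 / 5 ≤ lower
      lower-below  : p lower < 0ℚ
      upper-above  : 0ℚ < p (lower + powℚ ½ k)
      ∣p-lower∣≤   : ∣ p lower ∣ ≤ 10 * powℚ ½ k
      ∣p-upper∣≤   : ∣ p (lower + powℚ ½ k) ∣ ≤ 10 * powℚ ½ k

    upper : ℚ
    upper = lower + powℚ ½ k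

    6/5≤upper : 6 / 5 ≤ upper
    6/5≤upper = ℚP.≤-trans 6/5≤lower (subst (_≤ upper) (ℚP.+-identityʳ lower) (ℚP.+-monoʳ-≤ lower (pow-nonNeg k ≤-eval)))

  sign-change-bounds : ∀ {a b D} → a ≤ 0ℚ → 0ℚ ≤ b → b - a ≤ D → ∣ a ∣ ≤ D × ∣ b ∣ ≤ D
  sign-change-bounds {a} {b} {D} a≤0 0≤b b-a≤D =
    ∣p∣≤q (≤-byDiff _ (shift₁ a b D) (+-nonNeg slack 0≤b)) (≤-byDiff _ (shift₂ a b D) (+-nonNeg (+-nonNeg slack 0≤b) (+-nonNeg 0≤-a 0≤-a))) ,
    ∣p∣≤q (≤-byDiff _ (shift₃ a b D) (+-nonNeg (+-nonNeg slack 0≤b) (+-nonNeg 0≤b 0≤-a))) (≤-byDiff _ (shift₄ a b D) (+-nonNeg slack 0≤-a))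
    where
    slack : 0ℚ ≤ D - (b - a)
    slack = p≤q⇒0≤q-p b-a≤D
    0≤-a : 0ℚ ≤ - a
    0≤-a = ℚP.neg-antimono-≤ a≤0
    shift₁ : ∀ a b D → a - (- D) ≡ (D - (b - a)) + b
    shift₁ = solve-∀ ℚ-ring
    shift₂ : ∀ a b D → D - a ≡ ((D - (b - a)) + b) + ((- a) + (- a))
    shift₂ = solve-∀ ℚ-ring
    shift₃ : ∀ a b D → b - (- D) ≡ ((D - (b - a)) + b) + (b + (- a))
    shift₃ = solve-∀ ℚ-ring
    shift₄ : ∀ a b D → D - b ≡ (D - (b - a)) + (- a)
    shift₄ = solve-∀ ℚ-ring

  bisection⇒bracket : ∀ k {x} → 6 / 5 ≤ x → p x < 0ℚ → ¬ (6 / 5 ≤ x + ½ * powℚ ½ k × p (x + ½ * powℚ ½ k) < 0ℚ) → Bracket k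
  bisection⇒bracket k {x} 6/5≤x px<0 ¬below = record
    { lower       = x
    ; 6/5≤lower   = 6/5≤x
    ; lower-below = px<0
    ; upper-above = 0<p[x+w]
    ; ∣p-lower∣≤  = proj₁ bounds
    ; ∣p-upper∣≤  = proj₂ bounds
    }
    where
    w : ℚ
    w = powℚ ½ k
    0<w : 0ℚ < w
    0<w = pow-pos k <-eval
    x≤x+ : ∀ {v} → 0ℚ ≤ v → x ≤ x + v
    x≤x+ {v} 0≤v = subst (_≤ x + v) (ℚP.+-identityʳ x) (ℚP.+-monoʳ-≤ x 0≤v)
    x<4/3 : x < 4 / 3
    x<4/3 = below-root⇒<4/3 6/5≤x px<0
    0≤p[x+w/2] : 0ℚ ≤ p (x + ½ * w)
    0≤p[x+w/2] = ℚP.≮⇒≥ λ p<0 → ¬below (ℚP.≤-trans 6/5≤x (x≤x+ (*-nonNeg {½} ≤-eval (ℚP.<⇒≤ 0<w))) , p<0)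
    x+w/2<x+w : x + ½ * w < x + w
    x+w/2<x+w = ℚP.+-monoʳ-< x (<-byDiff (½ * w) (half w) (*-pos {½} <-eval 0<w))
      where
      half : ∀ w → w - ½ * w ≡ ½ * w
      half = solve-∀ ℚ-ring
    0<p[x+w] : 0ℚ < p (x + w)
    0<p[x+w] = ℚP.≤-<-trans 0≤p[x+w/2] (plasticPoly-increasing (ℚP.≤-trans 6/5≤x (x≤x+ (ℚP.<⇒≤ 0<w))) x+w/2<x+w)
    x+w≤7/3 : x + w ≤ 7 / 3
    x+w≤7/3 = ℚP.≤-trans (ℚP.+-mono-≤ (ℚP.<⇒≤ x<4/3) (pow-antitoneʳ ≤-eval ≤-eval (ℕ.z≤n {k}))) ≤-eval
    lipschitz : p (x + w) - p x ≤ 10 * w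
    lipschitz = subst (λ t → p (x + w) - p x ≤ 10 * t) ([p+q]-p≡q x w)
                  (plasticPoly-lipschitz (ℚP.≤-trans ≤-eval 6/5≤x) (ℚP.<⇒≤ x<4/3) (x≤x+ (ℚP.<⇒≤ 0<w)) x+w≤7/3)
    bounds : ∣ p x ∣ ≤ 10 * w × ∣ p (x + w) ∣ ≤ 10 * w
    bounds = sign-change-bounds (ℚP.<⇒≤ px<0) (ℚP.<⇒≤ 0<p[x+w]) lipschitz

  6/5-below : 6 / 5 ≤ 6 / 5 × p (6 / 5) < 0ℚ
  6/5-below = ≤-eval , <-eval

  6/5+½-not-below : ¬ (6 / 5 ≤ 6 / 5 + ½ × p (6 / 5 + ½) < 0ℚ)
  6/5+½-not-below (_ , p<0) = ℚP.<-asym p<0 <-eval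

  -- opaque: unfolding would run the bisection on concrete rationals during type checking
  opaque
    bracket : ∀ k → Bracket k
    bracket k with bisect (λ x → 6 / 5 ≤ x × p x < 0ℚ) (λ x → (6 / 5 ℚP.≤? x) ×-dec (p x ℚP.<? 0ℚ)) ½ 6/5-below 6/5+½-not-below k
    ... | x , (6/5≤x , px<0) , ¬below = bisection⇒bracket k 6/5≤x px<0 ¬below

  -- Perrin numbers against powers of approximations of ψ

  P : ℕ → ℚ
  P n = ℕtoℚ (perrin n)

  P-rec : ∀ n → P (3 ℕ.+ n) ≡ P (1 ℕ.+ n) + P n
  P-rec n = ℕtoℚ-+ (perrin (1 ℕ.+ n)) (perrin n)

  P-≤ : ∀ n → P n ≤ 3 * powℚ 4 n
  P-≤ 0 = ≤-eval
  P-≤ 1 = ≤-eval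
  P-≤ 2 = ≤-eval
  P-≤ (suc (suc (suc n))) = begin
    P (3 ℕ.+ n)                          ≡⟨ P-rec n ⟩
    P (1 ℕ.+ n) + P n                    ≤⟨ ℚP.+-mono-≤ (P-≤ (suc n)) (P-≤ n) ⟩
    3 * (4 * powℚ 4 n) + 3 * powℚ 4 n    ≤⟨ ≤-byDiff _ (slack (powℚ 4 n)) (*-nonNeg {177} ≤-eval (pow-nonNeg n ≤-eval)) ⟩
    3 * powℚ 4 (3 ℕ.+ n)                 ∎
    where
    open ℚP.≤-Reasoning
    slack : ∀ y → 3 * (4 * (4 * (4 * y))) - (3 * (4 * y) + 3 * y) ≡ 177 * y
    slack = solve-∀ ℚ-ring

  -- For x = ψ, d n = αⁿ + ᾱⁿ with α, ᾱ the roots of λ² + ψ λ + ψ² - 1 = (λ³ - λ - 1) / (λ - ψ):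
  -- then g vanishes and Q, positive definite by 4Q≡, is multiplied by αᾱ = ψ² - 1 at each step.
  module Errors (x : ℚ) where

    c : ℚ
    c = x * x - 1ℚ

    κ : ℚ
    κ = 3 * (x * x) - 4

    d : ℕ → ℚ
    d n = P n - powℚ x n

    g : ℕ → ℚ
    g n = d (2 ℕ.+ n) + x * d (1 ℕ.+ n) + c * d n

    h : ℕ → ℚ
    h n = x * d (1 ℕ.+ n) + 2 * c * d n

    Q : ℕ → ℚ
    Q n = d (1 ℕ.+ n) * d (1 ℕ.+ n) + x * d (1 ℕ.+ n) * d n + c * d n * d n

    g-zero : g 0 ≡ 0ℚ
    g-zero = expanded x
      where
      expanded : ∀ x → (2 - x * (x * 1ℚ)) + x * (0 - x * 1ℚ) + (x * x - 1ℚ) * (3 - 1ℚ) ≡ 0ℚ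
      expanded = solve-∀ ℚ-ring

    g-suc : ∀ n → g (suc n) ≡ x * g n - p x * P n
    g-suc n = trans (cong (λ t → (t - powℚ x (3 ℕ.+ n)) + x * d (2 ℕ.+ n) + c * d (1 ℕ.+ n)) (P-rec n))
                    (expanded x (P n) (P (1 ℕ.+ n)) (P (2 ℕ.+ n)) (powℚ x n))
      where
      expanded : ∀ x a b e y →
        ((b + a) - x * (x * (x * y))) + x * (e - x * (x * y)) + (x * x - 1ℚ) * (b - x * y)
        ≡ x * ((e - x * (x * y)) + x * (b - x * y) + (x * x - 1ℚ) * (a - y)) - (x * x * x - x - 1ℚ) * a
      expanded = solve-∀ ℚ-ring

    Q-zero : Q 0 ≡ κ
    Q-zero = expanded x
      where
      expanded : ∀ x → (0 - x * 1ℚ) * (0 - x * 1ℚ) + x * (0 - x * 1ℚ) * (3 - 1ℚ) + (x * x - 1ℚ) * (3 - 1ℚ) * (3 - 1ℚ)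
                       ≡ 3 * (x * x) - 4
      expanded = solve-∀ ℚ-ring

    Q-suc : ∀ n → Q (suc n) ≡ c * Q n + g n * (g n - h n)
    Q-suc n = expanded x (d (2 ℕ.+ n)) (d (1 ℕ.+ n)) (d n)
      where
      expanded : ∀ x u v w →
        u * u + x * u * v + (x * x - 1ℚ) * v * v
        ≡ (x * x - 1ℚ) * (v * v + x * v * w + (x * x - 1ℚ) * w * w)
          + (u + x * v + (x * x - 1ℚ) * w) * ((u + x * v + (x * x - 1ℚ) * w) - (x * v + 2 * (x * x - 1ℚ) * w))
      expanded = solve-∀ ℚ-ring

    4Q≡ : ∀ n → 4 * Q n ≡ (2 * d (1 ℕ.+ n) + x * d n) * (2 * d (1 ℕ.+ n) + x * d n) + κ * (d n * d n)
    4Q≡ n = expanded x (d (1 ℕ.+ n)) (d n)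
      where
      expanded : ∀ x v w → 4 * (v * v + x * v * w + (x * x - 1ℚ) * w * w)
                           ≡ (2 * v + x * w) * (2 * v + x * w) + (3 * (x * x) - 4) * (w * w)
      expanded = solve-∀ ℚ-ring

  module ErrorBounds {x δ : ℚ} (33/25≤x : 33 / 25 ≤ x) (x≤ : x ≤ 13249 / 10000)
                     (δ≤ : δ ≤ 1 / 9) (∣px∣≤δ : ∣ p x ∣ ≤ δ) where

    open Errors x

    private
      0≤x : 0ℚ ≤ x
      0≤x = ℚP.≤-trans ≤-eval 33/25≤x

      ∣x∣≤2 : ∣ x ∣ ≤ 2
      ∣x∣≤2 = subst (_≤ 2) (sym (ℚP.0≤p⇒∣p∣≡p 0≤x)) (ℚP.≤-trans x≤ ≤-eval)

      0≤δ : 0ℚ ≤ δ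
      0≤δ = ℚP.≤-trans (ℚP.0≤∣p∣ (p x)) ∣px∣≤δ

      0≤c : 0ℚ ≤ c
      0≤c = ℚP.≤-trans ≤-eval (ℚP.+-monoˡ-≤ (- 1ℚ) (*-mono-≤ ≤-eval ≤-eval 33/25≤x 33/25≤x))

      c≤ : c ≤ 3777 / 5000
      c≤ = ℚP.≤-trans (ℚP.+-monoˡ-≤ (- 1ℚ) (*-mono-≤ 0≤x 0≤x x≤ x≤)) ≤-eval

      c≤1 : c ≤ 1ℚ
      c≤1 = ℚP.≤-trans c≤ ≤-eval

      κ≥ : 767 / 625 ≤ κ
      κ≥ = ℚP.≤-trans ≤-eval (ℚP.+-monoˡ-≤ (- 4) (*-monoˡ-≤ 3 ≤-eval (*-mono-≤ ≤-eval ≤-eval 33/25≤x 33/25≤x)))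

      B : ℕ → ℚ
      B n = powℚ 4 n

      0≤B : ∀ n → 0ℚ ≤ B n
      0≤B n = pow-nonNeg n ≤-eval

      ∣P∣≤ : ∀ n → ∣ P n ∣ ≤ 3 * B n
      ∣P∣≤ n = subst (_≤ 3 * B n) (sym (ℚP.0≤p⇒∣p∣≡p (ℕtoℚ-nonNeg (perrin n)))) (P-≤ n)

    ∣d∣≤ : ∀ n → ∣ d n ∣ ≤ 4 * B n
    ∣d∣≤ n = begin
      ∣ P n - powℚ x n ∣          ≤⟨ ℚP.∣p-q∣≤∣p∣+∣q∣ (P n) (powℚ x n) ⟩
      ∣ P n ∣ + ∣ powℚ x n ∣      ≤⟨ ℚP.+-mono-≤ (∣P∣≤ n) ∣xⁿ∣≤ ⟩
      3 * B n + B n               ≡⟨ sum (B n) ⟩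
      4 * B n                     ∎
      where
      open ℚP.≤-Reasoning
      ∣xⁿ∣≤ : ∣ powℚ x n ∣ ≤ B n
      ∣xⁿ∣≤ = subst (_≤ B n) (sym (ℚP.0≤p⇒∣p∣≡p (pow-nonNeg n 0≤x))) (pow-mono-≤ n 0≤x (ℚP.≤-trans x≤ ≤-eval))
      sum : ∀ y → 3 * y + y ≡ 4 * y
      sum = solve-∀ ℚ-ring

    ∣g∣≤ : ∀ n → ∣ g n ∣ ≤ 3 * δ * B n
    ∣g∣≤ zero = subst (λ t → ∣ t ∣ ≤ 3 * δ * 1ℚ) (sym g-zero) (*-nonNeg (*-nonNeg {3} ≤-eval 0≤δ) ≤-eval)
    ∣g∣≤ (suc n) = begin
      ∣ g (suc n) ∣                        ≡⟨ cong ∣_∣ (g-suc n) ⟩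
      ∣ x * g n - p x * P n ∣              ≤⟨ ℚP.∣p-q∣≤∣p∣+∣q∣ (x * g n) (p x * P n) ⟩
      ∣ x * g n ∣ + ∣ p x * P n ∣          ≤⟨ ℚP.+-mono-≤ (∣*∣-≤ ∣x∣≤2 (∣g∣≤ n)) (∣*∣-≤ ∣px∣≤δ (∣P∣≤ n)) ⟩
      2 * (3 * δ * B n) + δ * (3 * B n)    ≤⟨ ≤-byDiff _ (slack δ (B n)) (*-nonNeg (*-nonNeg {3} ≤-eval 0≤δ) (0≤B n)) ⟩
      3 * δ * B (suc n)                    ∎
      where
      open ℚP.≤-Reasoning
      slack : ∀ δ y → 3 * δ * (4 * y) - (2 * (3 * δ * y) + δ * (3 * y)) ≡ 3 * δ * y
      slack = solve-∀ ℚ-ring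

    ∣h∣≤ : ∀ n → ∣ h n ∣ ≤ 40 * B n
    ∣h∣≤ n = begin
      ∣ x * d (1 ℕ.+ n) + 2 * c * d n ∣            ≤⟨ ℚP.∣p+q∣≤∣p∣+∣q∣ (x * d (1 ℕ.+ n)) (2 * c * d n) ⟩
      ∣ x * d (1 ℕ.+ n) ∣ + ∣ 2 * c * d n ∣        ≤⟨ ℚP.+-mono-≤ (∣*∣-≤ ∣x∣≤2 (∣d∣≤ (1 ℕ.+ n))) (∣*∣-≤ ∣2c∣≤2 (∣d∣≤ n)) ⟩
      2 * (4 * B (1 ℕ.+ n)) + 2 * (4 * B n)        ≡⟨ sum (B n) ⟩
      40 * B n                                     ∎
      where
      open ℚP.≤-Reasoning
      ∣2c∣≤2 : ∣ 2 * c ∣ ≤ 2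
      ∣2c∣≤2 = subst (_≤ 2) (sym (ℚP.0≤p⇒∣p∣≡p (*-nonNeg {2} ≤-eval 0≤c))) (*-monoˡ-≤ 2 ≤-eval c≤1)
      sum : ∀ y → 2 * (4 * (4 * y)) + 2 * (4 * y) ≡ 40 * y
      sum = solve-∀ ℚ-ring

    error≤ : ∀ n → g n * (g n - h n) ≤ 121 * δ * powℚ 16 n
    error≤ n = begin
      g n * (g n - h n)                          ≤⟨ p≤∣p∣ _ ⟩
      ∣ g n * (g n - h n) ∣                      ≤⟨ ∣*∣-≤ (∣g∣≤ n) (ℚP.≤-trans (ℚP.∣p-q∣≤∣p∣+∣q∣ (g n) (h n)) (ℚP.+-mono-≤ (∣g∣≤ n) (∣h∣≤ n))) ⟩
      (3 * δ * B n) * (3 * δ * B n + 40 * B n)   ≤⟨ ≤-byDiff _ (slack δ (B n)) (*-nonNeg (*-nonNeg 0≤δ (square-nonNeg (B n))) (p≤q⇒0≤q-p 9δ≤1)) ⟩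
      121 * δ * (B n * B n)                      ≡⟨ cong (121 * δ *_) (pow-*-distrib 4 4 n) ⟩
      121 * δ * powℚ 16 n                        ∎
      where
      open ℚP.≤-Reasoning
      9δ≤1 : 9 * δ ≤ 1ℚ
      9δ≤1 = ℚP.≤-trans (*-monoˡ-≤ 9 ≤-eval δ≤) ≤-eval
      slack : ∀ δ y → 121 * δ * (y * y) - (3 * δ * y) * (3 * δ * y + 40 * y) ≡ δ * (y * y) * (1ℚ - 9 * δ)
      slack = solve-∀ ℚ-ring

    Q≤ : ∀ n → Q n ≤ powℚ c n * κ + 9 * δ * powℚ 16 n
    Q≤ zero = ≤-byDiff _ (trans (cong (λ t → 1ℚ * κ + 9 * δ * 1ℚ - t) Q-zero) (slack κ δ)) (*-nonNeg {9} ≤-eval 0≤δ)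
      where
      slack : ∀ κ δ → 1ℚ * κ + 9 * δ * 1ℚ - κ ≡ 9 * δ
      slack = solve-∀ ℚ-ring
    Q≤ (suc n) = begin
      Q (suc n)                                         ≡⟨ Q-suc n ⟩
      c * Q n + g n * (g n - h n)                       ≤⟨ ℚP.+-mono-≤ (*-monoˡ-≤ c 0≤c (Q≤ n)) (error≤ n) ⟩
      c * (powℚ c n * κ + 9 * δ * F) + 121 * δ * F      ≤⟨ ≤-byDiff _ (slack c κ δ F (powℚ c n)) certificate ⟩
      powℚ c (suc n) * κ + 9 * δ * powℚ 16 (suc n)      ∎
      where
      open ℚP.≤-Reasoning
      F : ℚ
      F = powℚ 16 n
      0≤δF : 0ℚ ≤ δ * F
      0≤δF = *-nonNeg 0≤δ (pow-nonNeg n ≤-eval)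
      certificate : 0ℚ ≤ 9 * (δ * F) * (1ℚ - c) + 14 * (δ * F)
      certificate = +-nonNeg (*-nonNeg (*-nonNeg {9} ≤-eval 0≤δF) (p≤q⇒0≤q-p c≤1)) (*-nonNeg {14} ≤-eval 0≤δF)
      slack : ∀ c κ δ F a → c * a * κ + 9 * δ * (16 * F) - (c * (a * κ + 9 * δ * F) + 121 * δ * F)
                            ≡ 9 * (δ * F) * (1ℚ - c) + 14 * (δ * F)
      slack = solve-∀ ℚ-ring

    d²<¼ : ∀ n → 10 ℕ.≤ n → δ * powℚ 16 n ≤ 1 / 10000 → d n * d n < 1 / 4
    d²<¼ n 10≤n δF≤ = ℚP.*-cancelˡ-<-nonNeg κ {{ℚ.nonNegative (ℚP.≤-trans ≤-eval κ≥)}} (ℚP.≤-<-trans κd²≤ margin)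
      where
      open ℚP.≤-Reasoning
      a : ℚ
      a = powℚ c n
      a≤ : a ≤ powℚ (3777 / 5000) 10
      a≤ = ℚP.≤-trans (pow-antitoneʳ 0≤c c≤1 10≤n) (pow-mono-≤ 10 0≤c c≤)
      κd²≤ : κ * (d n * d n) ≤ 4 * (a * κ) + 36 / 10000
      κd²≤ = begin
        κ * (d n * d n)                    ≤⟨ ≤-byDiff _ (trans (cong (_- κ * (d n * d n)) (4Q≡ n)) ([u+v]-v≡u _ _))
                                                         (square-nonNeg (2 * d (1 ℕ.+ n) + x * d n)) ⟩
        4 * Q n                            ≤⟨ *-monoˡ-≤ 4 ≤-eval (Q≤ n) ⟩
        4 * (a * κ + 9 * δ * powℚ 16 n)    ≤⟨ ≤-byDiff _ (slack (a * κ) δ (powℚ 16 n)) (*-nonNeg {36} ≤-eval (p≤q⇒0≤q-p δF≤)) ⟩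
        4 * (a * κ) + 36 / 10000           ∎
        where
        [u+v]-v≡u : ∀ u v → (u + v) - v ≡ u
        [u+v]-v≡u = solve-∀ ℚ-ring
        slack : ∀ e δ F → (4 * e + 36 / 10000) - 4 * (e + 9 * δ * F) ≡ 36 * (1 / 10000 - δ * F)
        slack = solve-∀ ℚ-ring
      margin : 4 * (a * κ) + 36 / 10000 < κ * (1 / 4)
      margin = <-byDiff _ (rearrange κ a) (p<q⇒0<q-p (begin-strict
        36 / 10000                                        <⟨ <-eval ⟩
        767 / 625 * (1 / 4 - 4 * powℚ (3777 / 5000) 10)   ≤⟨ *-mono-≤ ≤-eval ≤-eval κ≥ (ℚP.+-monoʳ-≤ (1 / 4) (ℚP.neg-antimono-≤ (*-monoˡ-≤ 4 ≤-eval a≤))) ⟩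
        κ * (1 / 4 - 4 * a)                               ∎))
        where
        rearrange : ∀ κ a → κ * (1 / 4) - (4 * (a * κ) + 36 / 10000) ≡ κ * (1 / 4 - 4 * a) - 36 / 10000
        rearrange = solve-∀ ℚ-ring

  power-near-perrin : ∀ {x δ} → 6 / 5 ≤ x → ∣ p x ∣ ≤ δ →
                      ∀ n → 10 ℕ.≤ n → δ * powℚ 16 n ≤ 1 / 10000 → ∣ P n - powℚ x n ∣ < ½
  power-near-perrin {x} {δ} 6/5≤x ∣px∣≤δ n 10≤n δF≤ =
    square<¼⇒∣∣<½ (P n - powℚ x n) (ErrorBounds.d²<¼ (proj₁ x-range) (proj₂ x-range) (ℚP.≤-trans δ≤ ≤-eval) ∣px∣≤δ n 10≤n δF≤)
    where
    δ≤ : δ ≤ 1 / 10000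
    δ≤ = ℚP.≤-trans (subst (_≤ δ * powℚ 16 n) (ℚP.*-identityʳ δ)
                           (*-monoˡ-≤ δ (ℚP.≤-trans (ℚP.0≤∣p∣ (p x)) ∣px∣≤δ) (pow-monotoneʳ ≤-eval (ℕ.z≤n {n}))))
                    δF≤
    x-range : 33 / 25 ≤ x × x ≤ 13249 / 10000
    x-range = near-root 6/5≤x (ℚP.≤-trans ∣px∣≤δ δ≤)

  -- chosen so that 10 ½^(precision N) 16ⁿ ≤ 10 ½¹⁷ < 10⁻⁴ for n ≤ N
  precision : ℕ → ℕ
  precision N = N ℕ.* 4 ℕ.+ 17

  precision-scale : ∀ N → powℚ ½ (precision N) * powℚ 16 N ≡ powℚ ½ 17
  precision-scale zero    = ℚP.*-identityʳ _
  precision-scale (suc N) = trans (shift (powℚ ½ (precision N)) (powℚ 16 N)) (precision-scale N)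
    where
    shift : ∀ a y → (½ * (½ * (½ * (½ * a)))) * (16 * y) ≡ a * y
    shift = solve-∀ ℚ-ring

  module _ (N : ℕ) where
    open Bracket (bracket (precision N))

    bracket-rounds : ∀ n → 10 ℕ.≤ n → n ℕ.≤ N → ∣ P n - powℚ lower n ∣ < ½ × ∣ P n - powℚ upper n ∣ < ½
    bracket-rounds n 10≤n n≤N = power-near-perrin 6/5≤lower ∣p-lower∣≤ n 10≤n δF≤ ,
                                power-near-perrin 6/5≤upper ∣p-upper∣≤ n 10≤n δF≤
      where
      δ : ℚ
      δ = 10 * powℚ ½ (precision N)
      δF≤ : δ * powℚ 16 n ≤ 1 / 10000
      δF≤ = begin
        δ * powℚ 16 n      ≤⟨ *-monoˡ-≤ δ (*-nonNeg {10} ≤-eval (pow-nonNeg (precision N) ≤-eval)) (pow-monotoneʳ ≤-eval n≤N) ⟩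
        δ * powℚ 16 N      ≡⟨ trans (ℚP.*-assoc 10 (powℚ ½ (precision N)) (powℚ 16 N)) (cong (10 *_) (precision-scale N)) ⟩
        10 * powℚ ½ 17     ≤⟨ ≤-eval ⟩
        1 / 10000          ∎
        where open ℚP.≤-Reasoning

  perrin-rounds : ∀ n → 10 ℕ.≤ n → IsRoundPsiPow n (perrin n)
  perrin-rounds n 10≤n =
    (lower , ℚP.<-≤-trans <-eval 6/5≤lower , lower-below , proj₁ (∣a-b∣<½⇒ {P n} (proj₁ rounds))) ,
    (upper , upper-above , proj₂ (∣a-b∣<½⇒ {P n} (proj₂ rounds)))
    where
    open Bracket (bracket (precision n))
    rounds : ∣ P n - powℚ lower n ∣ < ½ × ∣ P n - powℚ upper n ∣ < ½
    rounds = bracket-rounds n n 10≤n ℕP.≤-refl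

  ratio-trapped : ∀ {r w q a b ε} → 0ℚ < a → q * a ≡ b → ∣ b - r * a ∣ ≤ 3 / 2 → w * a ≤ 1ℚ → 4 ≤ ε * a →
                  q - ε < r × r + w < q + ε
  ratio-trapped {r} {w} {q} {a} {b} {ε} 0<a qa≡b ∣b-ra∣≤ wa≤1 4≤εa =
    ℚP.*-cancelʳ-<-nonNeg a {{ℚ.nonNegative (ℚP.<⇒≤ 0<a)}} (<-byDiff _ (shift₁ q r a ε) below) ,
    ℚP.*-cancelʳ-<-nonNeg a {{ℚ.nonNegative (ℚP.<⇒≤ 0<a)}} (<-byDiff _ (shift₂ q r w a ε) above)
    where
    ∣qa-ra∣≤ : ∣ q * a - r * a ∣ ≤ 3 / 2
    ∣qa-ra∣≤ = subst (λ t → ∣ t - r * a ∣ ≤ 3 / 2) (sym qa≡b) ∣b-ra∣≤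
    0≤εa-4 : 0ℚ ≤ ε * a - 4
    0≤εa-4 = p≤q⇒0≤q-p 4≤εa
    below : 0ℚ < (ε * a - 4) + (3 / 2 - (q * a - r * a)) + 5 / 2
    below = nonNeg+pos (+-nonNeg 0≤εa-4 (p≤q⇒0≤q-p (ℚP.≤-trans (p≤∣p∣ _) ∣qa-ra∣≤))) (<-eval {0ℚ} {5 / 2})
    above : 0ℚ < (ε * a - 4) + ((q * a - r * a) - (- (3 / 2))) + (1ℚ - w * a) + 3 / 2
    above = nonNeg+pos (+-nonNeg (+-nonNeg 0≤εa-4 (p≤q⇒0≤q-p (ℚP.≤-trans (ℚP.neg-antimono-≤ ∣qa-ra∣≤) (-∣p∣≤p _))))
                                 (p≤q⇒0≤q-p wa≤1))
                       (<-eval {0ℚ} {3 / 2})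
    shift₁ : ∀ q r a ε → r * a - (q - ε) * a ≡ (ε * a - 4) + (3 / 2 - (q * a - r * a)) + 5 / 2
    shift₁ = solve-∀ ℚ-ring
    shift₂ : ∀ q r w a ε → (q + ε) * a - (r + w) * a ≡ (ε * a - 4) + ((q * a - r * a) - (- (3 / 2))) + (1ℚ - w * a) + 3 / 2
    shift₂ = solve-∀ ℚ-ring

  ratio-near-ψ : ∀ {ε q} n → 10 ℕ.≤ n → 0ℚ < P n → q * P n ≡ P (suc n) → 4 ≤ ε * P n → WithinOfPsi ε q
  ratio-near-ψ {ε} {q} n 10≤n 0<Pn qP≡P 4≤εP =
    ℚP.<-trans (plasticPoly-increasing 6/5≤lower (proj₁ trapped)) lower-below ,
    ℚP.<-trans upper-above (plasticPoly-increasing (ℚP.≤-trans 6/5≤upper (ℚP.<⇒≤ (proj₂ trapped))) (proj₂ trapped))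
    where
    open Bracket (bracket (precision (suc n)))
    w r : ℚ
    w = powℚ ½ (precision (suc n))
    r = lower
    ∣P₁-rP₀∣≤ : ∣ P (suc n) - r * P n ∣ ≤ 3 / 2
    ∣P₁-rP₀∣≤ = begin
      ∣ P (suc n) - r * P n ∣                                   ≡⟨ cong ∣_∣ (split (P (suc n)) (P n) r (powℚ r n)) ⟩
      ∣ (P (suc n) - powℚ r (suc n)) - r * (P n - powℚ r n) ∣   ≤⟨ ℚP.∣p-q∣≤∣p∣+∣q∣ (P (suc n) - powℚ r (suc n)) (r * (P n - powℚ r n)) ⟩
      ∣ P (suc n) - powℚ r (suc n) ∣ + ∣ r * (P n - powℚ r n) ∣ ≤⟨ ℚP.+-mono-≤ (ℚP.<⇒≤ ∣D₁∣<½) (∣*∣-≤ ∣r∣≤2 (ℚP.<⇒≤ ∣D₀∣<½)) ⟩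
      ½ + 2 * ½                                                 ≡⟨ refl ⟩
      3 / 2                                                     ∎
      where
      open ℚP.≤-Reasoning
      ∣D₀∣<½ : ∣ P n - powℚ r n ∣ < ½
      ∣D₀∣<½ = proj₁ (bracket-rounds (suc n) n 10≤n (ℕP.n≤1+n n))
      ∣D₁∣<½ : ∣ P (suc n) - powℚ r (suc n) ∣ < ½
      ∣D₁∣<½ = proj₁ (bracket-rounds (suc n) (suc n) (ℕP.m≤n⇒m≤1+n 10≤n) ℕP.≤-refl)
      ∣r∣≤2 : ∣ r ∣ ≤ 2
      ∣r∣≤2 = subst (_≤ 2) (sym (ℚP.0≤p⇒∣p∣≡p (ℚP.≤-trans ≤-eval 6/5≤lower)))
                    (ℚP.≤-trans (ℚP.<⇒≤ (below-root⇒<4/3 6/5≤lower lower-below)) ≤-eval)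
      split : ∀ b a r y → b - r * a ≡ (b - r * y) - r * (a - y)
      split = solve-∀ ℚ-ring
    wP≤1 : w * P n ≤ 1ℚ
    wP≤1 = begin
      w * P n                      ≤⟨ *-monoˡ-≤ w (pow-nonNeg (precision (suc n)) {½} ≤-eval) (ℚP.≤-trans (P-≤ n) (*-monoˡ-≤ 3 ≤-eval 4ⁿ≤16ⁿ⁺¹)) ⟩
      w * (3 * powℚ 16 (suc n))    ≡⟨ trans (swap w (powℚ 16 (suc n))) (cong (3 *_) (precision-scale (suc n))) ⟩
      3 * powℚ ½ 17                ≤⟨ ≤-eval ⟩
      1ℚ                           ∎
      where
      open ℚP.≤-Reasoning
      4ⁿ≤16ⁿ⁺¹ : powℚ 4 n ≤ powℚ 16 (suc n)
      4ⁿ≤16ⁿ⁺¹ = ℚP.≤-trans (pow-mono-≤ n {4} ≤-eval ≤-eval) (pow-monotoneʳ {16} ≤-eval (ℕP.n≤1+n n))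
      swap : ∀ w y → w * (3 * y) ≡ 3 * (w * y)
      swap = solve-∀ ℚ-ring
    trapped : q - ε < r × r + w < q + ε
    trapped = ratio-trapped {r} {w} {q} {P n} {P (suc n)} {ε} 0<Pn qP≡P ∣P₁-rP₀∣≤ wP≤1 4≤εP

  perrin-ratio→ψ : ∀ ε → 0ℚ < ε → ∃[ M ] ((n : ℕ) → M ℕ.≤ n → WithinOfPsi ε (ratioℕ (perrin (suc n)) (perrin n)))
  perrin-ratio→ψ ε 0<ε with archimedean 0<ε
  ... | b , 1≤εb = 3 ℕ.* (4 ℕ.* b) ℕ.+ 10 , λ n M≤n →
    ratio-near-ψ {ε} {ratioℕ (perrin (suc n)) (perrin n)} n (10≤ n M≤n) (0<P n M≤n)
                 (ratioℕ-* (perrin (suc n)) (1≤perrin n M≤n)) (4≤εP n M≤n)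
    where
    M : ℕ
    M = 3 ℕ.* (4 ℕ.* b) ℕ.+ 10
    10≤ : ∀ n → M ℕ.≤ n → 10 ℕ.≤ n
    10≤ n M≤n = ℕP.≤-trans (ℕP.m≤n+m 10 (3 ℕ.* (4 ℕ.* b))) M≤n
    1≤perrin : ∀ n → M ℕ.≤ n → 1 ℕ.≤ perrin n
    1≤perrin n M≤n = perrin-eventually-≥ 1 n (ℕP.≤-trans (ℕP.m≤m+n 5 5) (10≤ n M≤n))
    0<P : ∀ n → M ℕ.≤ n → 0ℚ < P n
    0<P n M≤n = ℚP.<-≤-trans <-eval (ℕtoℚ-mono-≤ (1≤perrin n M≤n))
    4≤εP : ∀ n → M ℕ.≤ n → 4 ≤ ε * P n
    4≤εP n M≤n = begin
      4                     ≤⟨ *-monoˡ-≤ 4 ≤-eval 1≤εb ⟩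
      4 * (ε * ℕtoℚ b)      ≡⟨ swap ε (ℕtoℚ b) ⟩
      ε * (4 * ℕtoℚ b)      ≡⟨ cong (ε *_) (ℕtoℚ-* 4 b) ⟨
      ε * ℕtoℚ (4 ℕ.* b)    ≤⟨ *-monoˡ-≤ ε (ℚP.<⇒≤ 0<ε) (ℕtoℚ-mono-≤ 4b≤perrin) ⟩
      ε * P n               ∎
      where
      open ℚP.≤-Reasoning
      4b≤perrin : 4 ℕ.* b ℕ.≤ perrin n
      4b≤perrin = perrin-eventually-≥ (4 ℕ.* b) n (ℕP.≤-trans (ℕP.+-monoʳ-≤ (3 ℕ.* (4 ℕ.* b)) (ℕP.m≤m+n 2 8)) M≤n)
      swap : ∀ ε y → 4 * (ε * y) ≡ ε * (4 * y)
      swap = solve-∀ ℚ-ring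

open MinimalForts using (numMinForts≡perrin)
open PsiApproximation using (perrin-rounds; perrin-ratio→ψ)
open import Data.Nat using (_≤_)
open import Data.Product using (_×_; _,_; proj₁; proj₂; ∃-syntax)
open import Data.Rational using (_<_; 0ℚ)

numMinForts≡perrin′ : ∀ n → 3 ≤ n → numMinForts n ≡ perrin n
numMinForts≡perrin′ (suc (suc (suc k))) _ = numMinForts≡perrin k
numMinForts≡perrin′ 0 ()
numMinForts≡perrin′ 1 (ℕ.s≤s ())
numMinForts≡perrin′ 2 (ℕ.s≤s (ℕ.s≤s ()))

corollary4p7 :
    ((n : ℕ) → 10 ≤ n → IsRoundPsiPow n (numMinForts n))
    × ((ε : ℚ) → 0ℚ < ε → ∃[ M ] ((n : ℕ) → M ≤ n →
        WithinOfPsi ε (ratioℕ (numMinForts (suc n)) (numMinForts n))))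
corollary4p7 = rounding , ratios
  where
  rounding : (n : ℕ) → 10 ≤ n → IsRoundPsiPow n (numMinForts n)
  rounding n 10≤n =
    subst (IsRoundPsiPow n) (sym (numMinForts≡perrin′ n (ℕP.≤-trans (ℕP.m≤m+n 3 7) 10≤n))) (perrin-rounds n 10≤n)
  ratios : (ε : ℚ) → 0ℚ < ε → ∃[ M ] ((n : ℕ) → M ≤ n →
             WithinOfPsi ε (ratioℕ (numMinForts (suc n)) (numMinForts n)))
  ratios ε 0<ε = 3 ℕ.+ M , within
    where
    M : ℕ
    M = proj₁ (perrin-ratio→ψ ε 0<ε)
    within : (n : ℕ) → 3 ℕ.+ M ≤ n → WithinOfPsi ε (ratioℕ (numMinForts (suc n)) (numMinForts n))
    within n 3+M≤n =
      subst₂ (λ a b → WithinOfPsi ε (ratioℕ a b))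
             (sym (numMinForts≡perrin′ (suc n) (ℕP.≤-trans (ℕP.m≤m+n 3 M) (ℕP.m≤n⇒m≤1+n 3+M≤n))))
             (sym (numMinForts≡perrin′ n (ℕP.≤-trans (ℕP.m≤m+n 3 M) 3+M≤n)))
             (proj₂ (perrin-ratio→ψ ε 0<ε) n (ℕP.≤-trans (ℕP.m≤n+m M 3) 3+M≤n))
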